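{- Let $G$ be a weighted graph and let $a,b$ be distinct vertices of $G$ that are adjacent and both unlooped. Let $(G^{ab}-b)'$ denote the weighted graph obtained from $G^{ab}-b$ by changing the weights of $a$ to $\alpha'(a)=\beta(b)$ and $\beta'(a)=\alpha(b)(x-1)^{2}$ (all other vertices keep their weights). Then \[ q(G)=\beta(a)\,q(G-a)+\alpha(a)\,q\big((G^{ab}-b)'\big). \]
   Context: All graphs are finite and may have loops (at most one per vertex) but no multiple edges. The adjacency matrix of a graph is the symmetric $0/1$ matrix over $GF(2)$ whose diagonal entry at $v$ is $1$ iff $v$ is looped; $r(G)$ and $n(G)$ denote its rank and nullity over $GF(2)$ (the empty graph has $r=n=0$). For $S\subseteq V(G)$, $G[S]$ is the induced subgraph. Let $A$ be a commutative ring with unity containing elements $x,y$ (e.g. $A=R[x,y]$). A weighted graph is a graph $G$ together with functions $\alpha,\beta:V(G)\to A$, and its weighted interlace polynomial is \[ q(G)=\sum_{S\subseteq V(G)}\Big(\prod_{s\in S}\alpha(s)\Big)\Big(\prod_{v\notin S}\beta(v)\Big)(x-1)^{r(G[S])}(y-1)^{n(G[S])}. \] When a graph is modified (vertex deletion, pivot) the remaining vertices keep their weights unless stated otherwise. Pivot: for distinct vertices $a,b$, $G^{ab}$ is obtained from $G$ by toggling (adding if absent, removing if present) the adjacency $\{u,w\}$ for every pair with $u,w\notin\{a,b\}$, $u$ adjacent to $a$, $w$ adjacent to $b$, and either $u$ not adjacent to $b$ or $w$ not adjacent to $a$ (loops are not toggled). -}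

module Defs where

open import Data.Bool using (Bool; true; false; not; _∧_; _∨_; _xor_; if_then_else_)
open import Data.Nat using (ℕ; zero; suc; _∸_; _⊔_)
open import Data.Fin using (Fin; punchIn; _≟_)
open import Data.Vec using (Vec; []; _∷_; lookup)
open import Data.List using (List; [_]; _++_; map; foldr; allFin)
open import Data.Bool.ListAction using (all; any)
open import Level using (Level)
open import Relation.Nullary using (does)
open import Relation.Binary.PropositionalEquality using (_≡_)
open import Algebra.Bundles using (CommutativeRing)

-- Graphs on the vertex set Fin n, given by their adjacency matrix over
-- GF(2) (= Bool with xor/and).  Diagonal entry true = vertex is looped.

Graph : ℕ → Set
Graph n = Fin n → Fin n → Bool

IsSymmetric : ∀ {n} → Graph n → Set
IsSymmetric G = ∀ u v → G u v ≡ G v u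

Subset : ℕ → Set
Subset n = Vec Bool n

subsets : (n : ℕ) → List (Subset n)
subsets zero = [ [] ]
subsets (suc n) = map (false ∷_) (subsets n) ++ map (true ∷_) (subsets n)

_==_ : ∀ {n} → Fin n → Fin n → Bool
u == w = does (u ≟ w)

card : ∀ {n} → Subset n → ℕ
card {n} S = foldr (λ i k → if lookup S i then suc k else k) 0 (allFin n)

_⊆ᵇ_ : ∀ {n} → Subset n → Subset n → Bool
_⊆ᵇ_ {n} U T = all (λ i → not (lookup U i) ∨ lookup T i) (allFin n)

nonEmpty : ∀ {n} → Subset n → Bool
nonEmpty {n} U = any (lookup U) (allFin n)

rowSum : ∀ {n} → Graph n → Subset n → Fin n → Bool
rowSum {n} M U j = foldr (λ i b → (lookup U i ∧ M i j) xor b) false (allFin n)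

independent : ∀ {n} → Graph n → Subset n → Subset n → Bool
independent {n} M S T =
  all (λ U → not ((U ⊆ᵇ T) ∧ nonEmpty U)
             ∨ any (λ j → lookup S j ∧ rowSum M U j) (allFin n))
      (subsets n)

-- r(G[S]): rank over GF(2) of the principal submatrix M[S,S], i.e. the
-- maximum number of linearly independent rows of that submatrix.
rankOn : ∀ {n} → Graph n → Subset n → ℕ
rankOn {n} M S =
  foldr _⊔_ 0 (map (λ T → if (T ⊆ᵇ S) ∧ independent M S T then card T else 0)
                   (subsets n))

nullityOn : ∀ {n} → Graph n → Subset n → ℕ
nullityOn M S = card S ∸ rankOn M S

delete : ∀ {m} → Fin (suc m) → Graph (suc m) → Graph m
delete v G i j = G (punchIn v i) (punchIn v j)

restrict : ∀ {m} {l : Level} {A : Set l} → Fin (suc m) → (Fin (suc m) → A) → (Fin m → A)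
restrict v f i = f (punchIn v i)

pivot : ∀ {n} → Graph n → Fin n → Fin n → Graph n
pivot G a b u w =
  G u w xor (not ((u == a) ∨ (u == b) ∨ (w == a) ∨ (w == b) ∨ (u == w))
             ∧ (cond u w ∨ cond w u))
  where
  cond : _ → _ → Bool
  cond s t = G s a ∧ G t b ∧ (not (G s b) ∨ not (G t a))

module _ {c ℓ} (R : CommutativeRing c ℓ) where
  open CommutativeRing R

  pow : Carrier → ℕ → Carrier
  pow z zero = 1#
  pow z (suc k) = z * pow z k

  sumR : List Carrier → Carrier
  sumR = foldr _+_ 0#

  prodR : List Carrier → Carrier
  prodR = foldr _*_ 1#

  q : Carrier → Carrier → ∀ {n} → Graph n → (α β : Fin n → Carrier) → Carrier
  q x y {n} G α β =
    sumR (map (λ S →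
         prodR (map (λ s → if lookup S s then α s else 1#) (allFin n))
       * prodR (map (λ v → if lookup S v then 1# else β v) (allFin n))
       * pow (x + - 1#) (rankOn G S)
       * pow (y + - 1#) (nullityOn G S))
      (subsets n))

  alphaPrime : ∀ {n} → Fin n → Fin n → (α β : Fin n → Carrier) → Fin n → Carrier
  alphaPrime a b α β v = if v == a then β b else α v

  betaPrime : ∀ {n} → Carrier → Fin n → Fin n → (α β : Fin n → Carrier) → Fin n → Carrier
  betaPrime x a b α β v = if v == a then α b * pow (x + - 1#) 2 else β v

-- Split the sum defining q(G) according to whether a ∈ S: the subsets avoiding a give
-- β(a) q(G − a). The subsets S ∋ a correspond to the subsets T of V(G) − b, via T = S when
-- b ∉ S (then a ∈ T, with weight α(a)β(b)) and T = S − {a, b} when b ∈ S (then a ∉ T, with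
-- weight α(a)α(b)). When a ∈ S ∌ b, the matrix of
-- G^{ab}[S] is obtained from that of G[S] by adding row a and column a (a is unlooped) to the
-- rows and columns of the neighbours of b, so the rank is unchanged. When a, b ∈ S, clearing the
-- entries of rows S − {a, b} in columns a and b by row operations leaves the nonsingular 2 × 2
-- block on {a, b} next to G^{ab}[S − {a, b}], so r(G[S]) = 2 + r(G^{ab}[S − {a, b}]) while the
-- nullity is unchanged; this is the factor (x − 1)² in β′(a). As the rank is defined as the
-- largest number of independent rows, its invariance under row operations is proved by an
-- exchange argument.

module Submission where

open import Defs
open import Level using (Level)
open import Function using (id; _∘_; _⟨_⟩_)
open import Data.Bool using (Bool; true; false; not; _∧_; _∨_; _xor_; if_then_else_)
open import Data.Bool.Properties
  using (xor-∧-commutativeRing; ∨-zeroʳ; xor-identityʳ; xor-assoc; xor-same; ∧-identityʳ; ∧-assoc; ∧-comm; ∧-distribʳ-xor; ∧-zeroʳ)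
open import Data.Nat using (ℕ; zero; suc; _+_; _∸_; _⊔_; _≤_; z≤n)
open import Data.Nat.Properties
  using (≤-refl; ≤-reflexive; ≤-trans; ≤-antisym; module ≤-Reasoning; m≤m⊔n; m≤n⊔m; ⊔-sel)
import Data.Nat.Properties as ℕₚ
open import Data.Fin using (Fin; zero; suc; punchIn; punchOut; _≟_)
open import Data.Fin.Properties using (punchInᵢ≢i; punchIn-injective; punchIn-punchOut)
open import Data.Vec using ([]; _∷_; lookup; tabulate; insertAt)
open import Data.Vec.Properties using (lookup∘tabulate; insertAt-lookup; insertAt-punchIn)
open import Data.Vec.Functional.Properties using ()
  renaming (insertAt-lookup to insertAtᶠ-lookup; insertAt-punchIn to insertAtᶠ-punchIn)
import Data.Vec.Functional as Vector
open import Data.List using ([]; _∷_; _++_; map; foldr; allFin)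
import Data.List as List
open import Data.List.Properties using (foldr-map; map-tabulate; map-++; map-∘)
open import Data.List.Membership.Propositional using (_∈_)
open import Data.List.Membership.Propositional.Properties using (∈-allFin; ∈-map⁺; ∈-++⁺ˡ; ∈-++⁺ʳ)
open import Data.List.Relation.Unary.Any using (here; there)
open import Data.Bool.ListAction using (all; any)
open import Data.Sum using (_⊎_; inj₁; inj₂)
open import Data.Empty using (⊥-elim)
open import Data.Nat.Tactic.RingSolver using (solve-∀)
open import Data.Maybe using (nothing)
open import Tactic.RingSolver.Core.AlmostCommutativeRing using (AlmostCommutativeRing; fromCommutativeRing)
import Tactic.RingSolver as Reflective
open import Data.Product using (∃; _×_; _,_; proj₁; proj₂)
open import Relation.Nullary using (yes; no)
open import Relation.Nullary.Decidable using (dec-true; dec-false)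
open import Relation.Binary.PropositionalEquality
  using (_≡_; _≢_; refl; sym; trans; cong; cong₂; subst₂; module ≡-Reasoning)
open import Algebra.Bundles using (CommutativeRing)
import Algebra.Properties.Semiring.Sum as SemiringSum
import Algebra.Properties.CommutativeMonoid.Sum as CommutativeMonoidSum

private
  variable
    ℓ ℓ′ : Level
    A : Set ℓ
    B : Set ℓ′

true≢false : true ≢ false
true≢false ()

true-false⇒≢ : ∀ {n} (f : Fin n → Bool) {i k} → f i ≡ true → f k ≡ false → i ≢ k
true-false⇒≢ f fi fk refl = true≢false (trans (sym fi) fk)

≡true⊎≡false : ∀ x → x ≡ true ⊎ x ≡ false
≡true⊎≡false true = inj₁ refl
≡true⊎≡false false = inj₂ refl

xor≡true⇒ : ∀ x {y} → x xor y ≡ true → x ≡ true ⊎ y ≡ true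
xor≡true⇒ true _ = inj₁ refl
xor≡true⇒ false h = inj₂ h

xor≡false⇒ : ∀ x {y} → x xor y ≡ false → x ≡ y
xor≡false⇒ true {true} _ = refl
xor≡false⇒ false h = sym h

xor-cancel : ∀ x y → (x xor y) xor y ≡ x
xor-cancel x y = xor-assoc x y y ⟨ trans ⟩ cong (x xor_) (xor-same y) ⟨ trans ⟩ xor-identityʳ x

∧≡true⇒ : ∀ {x y} → x ∧ y ≡ true → x ≡ true × y ≡ true
∧≡true⇒ {true} {true} _ = refl , refl

∧≡true⇐ : ∀ {x y} → x ≡ true → y ≡ true → x ∧ y ≡ true
∧≡true⇐ refl refl = refl

not∨-elim : ∀ {x y} → not x ∨ y ≡ true → x ≡ true → y ≡ true
not∨-elim imp refl = imp

not∨-intro : ∀ {x y} → (x ≡ true → y ≡ true) → not x ∨ y ≡ true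
not∨-intro {false} _ = refl
not∨-intro {true} x⇒y = x⇒y refl

==-refl : ∀ {n} (v : Fin n) → (v == v) ≡ true
==-refl v = dec-true (v ≟ v) refl

==-≢ : ∀ {n} {u v : Fin n} → u ≢ v → (u == v) ≡ false
==-≢ {u = u} {v} = dec-false (u ≟ v)

≡⊎≢ : ∀ {n} (k a : Fin n) → k ≡ a ⊎ k ≢ a
≡⊎≢ k a with k ≟ a
... | yes k≡a = inj₁ k≡a
... | no k≢a = inj₂ k≢a

≡⊎punchIn : ∀ {n} (v k : Fin (suc n)) → k ≡ v ⊎ ∃ λ k' → punchIn v k' ≡ k
≡⊎punchIn v k with ≡⊎≢ k v
... | inj₁ k≡v = inj₁ k≡v
... | inj₂ k≢v = inj₂ (punchOut (k≢v ∘ sym) , punchIn-punchOut (k≢v ∘ sym))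

punchIn-punchOut-comm : ∀ {n} {a b : Fin (suc (suc n))} (a≢b : a ≢ b) (j : Fin n) →
  punchIn a (punchIn (punchOut a≢b) j) ≡ punchIn b (punchIn (punchOut (a≢b ∘ sym)) j)
punchIn-punchOut-comm {a = zero} {zero} a≢b j = ⊥-elim (a≢b refl)
punchIn-punchOut-comm {a = zero} {suc b} a≢b j = refl
punchIn-punchOut-comm {a = suc a} {zero} a≢b j = refl
punchIn-punchOut-comm {zero} {suc zero} {suc zero} a≢b j = ⊥-elim (a≢b refl)
punchIn-punchOut-comm {suc n} {suc a} {suc b} a≢b zero = refl
punchIn-punchOut-comm {suc n} {suc a} {suc b} a≢b (suc j) = cong suc (punchIn-punchOut-comm (a≢b ∘ cong suc) j)

foldr-tabulate : ∀ {n} (f : A → B → B) e (g : Fin n → A) →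
                 foldr f e (List.tabulate g) ≡ Vector.foldr f e g
foldr-tabulate {n = zero}  f e g = refl
foldr-tabulate {n = suc n} f e g = cong (f (g zero)) (foldr-tabulate f e (g ∘ suc))

foldr-map-allFin : ∀ {n} (f : A → B → B) e (g : Fin n → A) →
                   foldr f e (map g (allFin n)) ≡ Vector.foldr f e g
foldr-map-allFin f e g = trans (cong (foldr f e) (map-tabulate id g)) (foldr-tabulate f e g)

GF₂ : AlmostCommutativeRing _ _
GF₂ = fromCommutativeRing xor-∧-commutativeRing (λ _ → nothing)

module Σ₂ = SemiringSum (CommutativeRing.semiring xor-∧-commutativeRing)

∑-false : ∀ {n} (f : Fin n → Bool) → (∀ i → f i ≡ false) → Σ₂.sum f ≡ false
∑-false {n} f h = trans (Σ₂.sum-cong-≗ h) (Σ₂.sum-replicate-zero n)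

∑≡true⇒ : ∀ {n} (f : Fin n → Bool) → Σ₂.sum f ≡ true → ∃ λ i → f i ≡ true
∑≡true⇒ {suc n} f h with f zero in eq
... | true = zero , eq
... | false = let (i , fi) = ∑≡true⇒ (f ∘ suc) h in suc i , fi

module ℕΣ = CommutativeMonoidSum ℕₚ.+-0-commutativeMonoid

bit : Bool → ℕ
bit b = if b then 1 else 0

count : ∀ {n} → (Fin n → Bool) → ℕ
count t = ℕΣ.sum (bit ∘ t)

card≡count : ∀ {n} (S : Subset n) → card S ≡ count (lookup S)
card≡count {n} S =
  trans (sym (foldr-map step (lookup S) 0 (allFin n)))
        (trans (foldr-map-allFin step 0 (lookup S)) (foldr-step (lookup S)))
  where
  step : Bool → ℕ → ℕ
  step b k = if b then suc k else k
  foldr-step : ∀ {m} (t : Fin m → Bool) → Vector.foldr step 0 t ≡ count t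
  foldr-step {zero} t = refl
  foldr-step {suc m} t with t zero
  ... | true = cong suc (foldr-step (t ∘ suc))
  ... | false = foldr-step (t ∘ suc)

bit≤1 : ∀ x → bit x ≤ 1
bit≤1 true = ≤-refl
bit≤1 false = z≤n

count-cong : ∀ {n} {t t' : Fin n → Bool} → (∀ i → t i ≡ t' i) → count t ≡ count t'
count-cong h = ℕΣ.sum-cong-≗ (λ i → cong bit (h i))

count-remove : ∀ {n} (v : Fin (suc n)) (t : Fin (suc n) → Bool) → count t ≡ bit (t v) + count (t ∘ punchIn v)
count-remove v t = ℕΣ.sum-remove {i = v} (bit ∘ t)

count-remove₂ : ∀ {n} {a b : Fin (suc (suc n))} (a≢b : a ≢ b) (t : Fin (suc (suc n)) → Bool) →
  count t ≡ bit (t a) + (bit (t b) + count (t ∘ punchIn a ∘ punchIn (punchOut a≢b)))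
count-remove₂ {a = a} a≢b t = trans (count-remove a t) (cong (bit (t a) +_) (trans (count-remove (punchOut a≢b) (t ∘ punchIn a))
  (cong (λ k → bit (t k) + count (t ∘ punchIn a ∘ punchIn (punchOut a≢b))) (punchIn-punchOut a≢b))))

count-agree-off₂ : ∀ {n} {a b : Fin n} (t t' : Fin n → Bool) → a ≢ b → (∀ k → k ≢ a → k ≢ b → t k ≡ t' k) →
  count t + (bit (t' a) + bit (t' b)) ≡ count t' + (bit (t a) + bit (t b))
count-agree-off₂ {suc zero} {zero} {zero} t t' a≢b agree = ⊥-elim (a≢b refl)
count-agree-off₂ {suc (suc n)} {a} {b} t t' a≢b agree = begin
  count t + (bit (t' a) + bit (t' b))
    ≡⟨ cong (_+ (bit (t' a) + bit (t' b))) (count-remove₂ a≢b t) ⟩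
  (bit (t a) + (bit (t b) + rest t)) + (bit (t' a) + bit (t' b))
    ≡⟨ cong (λ r → (bit (t a) + (bit (t b) + r)) + (bit (t' a) + bit (t' b))) (count-cong λ k → agree _ (a≢k k) (b≢k k)) ⟩
  (bit (t a) + (bit (t b) + rest t')) + (bit (t' a) + bit (t' b))
    ≡⟨ rearrange (bit (t a)) (bit (t b)) (rest t') (bit (t' a)) (bit (t' b)) ⟩
  (bit (t' a) + (bit (t' b) + rest t')) + (bit (t a) + bit (t b))
    ≡⟨ cong (_+ (bit (t a) + bit (t b))) (count-remove₂ a≢b t') ⟨
  count t' + (bit (t a) + bit (t b)) ∎
  where
  open ≡-Reasoning
  rest : (Fin (suc (suc n)) → Bool) → ℕ
  rest u = count (u ∘ punchIn a ∘ punchIn (punchOut a≢b))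
  a≢k : ∀ k → punchIn a (punchIn (punchOut a≢b) k) ≢ a
  a≢k k = punchInᵢ≢i a _
  b≢k : ∀ k → punchIn a (punchIn (punchOut a≢b) k) ≢ b
  b≢k k eq = punchInᵢ≢i (punchOut a≢b) k (punchIn-injective a _ _ (trans eq (sym (punchIn-punchOut a≢b))))
  rearrange : ∀ x y r x' y' → (x + (y + r)) + (x' + y') ≡ (x' + (y' + r)) + (x + y)
  rearrange = solve-∀

card-delete : ∀ {m} v (S : Subset (suc m)) S' → lookup S v ≡ false → (∀ i → lookup S (punchIn v i) ≡ lookup S' i) →
  card S ≡ card S'
card-delete v S S' Sv S∘punchIn = begin
  card S                                        ≡⟨ card≡count S ⟩
  count (lookup S)                              ≡⟨ count-remove v (lookup S) ⟩
  bit (lookup S v) + count (lookup S ∘ punchIn v) ≡⟨ cong₂ (λ x y → bit x + y) Sv (count-cong S∘punchIn) ⟩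
  count (lookup S')                             ≡⟨ card≡count S' ⟨
  card S'                                       ∎
  where open ≡-Reasoning

card-two-more : ∀ {n} {a b : Fin n} (S S₀ : Subset n) → a ≢ b →
  lookup S a ≡ true → lookup S b ≡ true → lookup S₀ a ≡ false → lookup S₀ b ≡ false →
  (∀ k → k ≢ a → k ≢ b → lookup S₀ k ≡ lookup S k) → card S ≡ 2 + card S₀
card-two-more {a = a} {b} S S₀ a≢b Sa Sb S₀a S₀b agree = begin
  card S                                               ≡⟨ trans (card≡count S) (sym (ℕₚ.+-identityʳ _)) ⟩
  count (lookup S) + 0                                ≡⟨ cong₂ (λ x y → count (lookup S) + (bit x + bit y)) S₀a S₀b ⟨
  count (lookup S) + (bit (lookup S₀ a) + bit (lookup S₀ b))
    ≡⟨ count-agree-off₂ (lookup S₀) (lookup S) a≢b agree ⟨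
  count (lookup S₀) + (bit (lookup S a) + bit (lookup S b))
    ≡⟨ cong₂ (λ x y → count (lookup S₀) + (bit x + bit y)) Sa Sb ⟩
  count (lookup S₀) + 2                               ≡⟨ ℕₚ.+-comm _ 2 ⟩
  2 + count (lookup S₀)                               ≡⟨ cong (2 +_) (card≡count S₀) ⟨
  2 + card S₀                                         ∎
  where open ≡-Reasoning

∅ : ∀ {n} → Fin n → Bool
∅ _ = false

count-∅ : ∀ n → count {n} ∅ ≡ 0
count-∅ n = ℕΣ.sum-replicate-zero n

-- Vectors over GF(2)

_⊕_ : ∀ {n} → (Fin n → Bool) → (Fin n → Bool) → (Fin n → Bool)
(u ⊕ v) i = u i xor v i

_·_ : ∀ {n} → Bool → (Fin n → Bool) → (Fin n → Bool)
(p · u) i = p ∧ u i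

⁅_⁆ : ∀ {n} → Fin n → (Fin n → Bool)
⁅ a ⁆ i = i == a

_∙_ : ∀ {n} → (Fin n → Bool) → (Fin n → Bool) → Bool
u ∙ v = Σ₂.sum (λ i → u i ∧ v i)

column : ∀ {n} → Graph n → Fin n → (Fin n → Bool)
column M j i = M i j

rowSum≡∙ : ∀ {n} (M : Graph n) (U : Subset n) j → rowSum M U j ≡ lookup U ∙ column M j
rowSum≡∙ {n} M U j = trans (sym (foldr-map _xor_ g false (allFin n))) (foldr-map-allFin _xor_ false g)
  where g = λ i → lookup U i ∧ M i j

∙-comm : ∀ {n} (u v : Fin n → Bool) → u ∙ v ≡ v ∙ u
∙-comm u v = Σ₂.sum-cong-≗ (λ i → ∧-comm (u i) (v i))

∙-⊕ˡ : ∀ {n} (u v w : Fin n → Bool) → (u ⊕ v) ∙ w ≡ (u ∙ w) xor (v ∙ w)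
∙-⊕ˡ u v w = trans (Σ₂.sum-cong-≗ (λ i → ∧-distribʳ-xor (w i) (u i) (v i)))
                   (Σ₂.∑-distrib-+ (λ i → u i ∧ w i) (λ i → v i ∧ w i))

∙-·ˡ : ∀ {n} p (u v : Fin n → Bool) → (p · u) ∙ v ≡ p ∧ (u ∙ v)
∙-·ˡ p u v = trans (Σ₂.sum-cong-≗ (λ i → ∧-assoc p (u i) (v i)))
                   (sym (Σ₂.*-distribˡ-sum p (λ i → u i ∧ v i)))

∙-⊕ʳ : ∀ {n} (u v w : Fin n → Bool) → u ∙ (v ⊕ w) ≡ (u ∙ v) xor (u ∙ w)
∙-⊕ʳ u v w = trans (∙-comm u (v ⊕ w)) (trans (∙-⊕ˡ v w u) (cong₂ _xor_ (∙-comm v u) (∙-comm w u)))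

∙-·ʳ : ∀ {n} p (u v : Fin n → Bool) → u ∙ (p · v) ≡ p ∧ (u ∙ v)
∙-·ʳ p u v = trans (∙-comm u (p · v)) (trans (∙-·ˡ p v u) (cong (p ∧_) (∙-comm v u)))

⁅⁆-∙ : ∀ {n} (a : Fin n) (v : Fin n → Bool) → ⁅ a ⁆ ∙ v ≡ v a
⁅⁆-∙ {suc n} a v = begin
  ⁅ a ⁆ ∙ v                                             ≡⟨ Σ₂.sum-remove {i = a} (λ i → ⁅ a ⁆ i ∧ v i) ⟩
  ((a == a) ∧ v a) xor Σ₂.sum (λ j → ⁅ a ⁆ (punchIn a j) ∧ v (punchIn a j))
    ≡⟨ cong₂ (λ x y → (x ∧ v a) xor y) (==-refl a) (∑-false _ (λ j → cong (_∧ v (punchIn a j)) (==-≢ (punchInᵢ≢i a j)))) ⟩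
  v a xor false                                          ≡⟨ xor-identityʳ (v a) ⟩
  v a                                                    ∎
  where open ≡-Reasoning

∙-disjoint : ∀ {n} (u v : Fin n → Bool) → (∀ i → u i ≡ true → v i ≡ false) → u ∙ v ≡ false
∙-disjoint u v h = ∑-false _ pointwise
  where
  pointwise : ∀ i → u i ∧ v i ≡ false
  pointwise i with u i in ui
  ... | false = refl
  ... | true = h i ui

∙≡true⇒ : ∀ {n} (u v : Fin n → Bool) → u ∙ v ≡ true → ∃ λ i → u i ≡ true × v i ≡ true
∙≡true⇒ u v h with ∑≡true⇒ _ h
... | i , uvi with u i in ui | v i in vi
... | true | true = i , ui , vi

toggle-here : ∀ {n} (u : Fin n → Bool) p a → (u ⊕ (p · ⁅ a ⁆)) a ≡ u a xor p
toggle-here u p a = cong (λ x → u a xor (p ∧ x)) (==-refl a) ⟨ trans ⟩ cong (u a xor_) (∧-identityʳ p)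

toggle-there : ∀ {n} (u : Fin n → Bool) p {a k} → k ≢ a → (u ⊕ (p · ⁅ a ⁆)) k ≡ u k
toggle-there u p {k = k} k≢a =
  cong (λ x → u k xor (p ∧ x)) (==-≢ k≢a) ⟨ trans ⟩ (cong (u k xor_) (∧-zeroʳ p) ⟨ trans ⟩ xor-identityʳ (u k))

∙-toggle : ∀ {n} (u : Fin n → Bool) p a v → (u ⊕ (p · ⁅ a ⁆)) ∙ v ≡ (u ∙ v) xor (p ∧ v a)
∙-toggle u p a v = trans (∙-⊕ˡ u (p · ⁅ a ⁆) v) (cong ((u ∙ v) xor_) (trans (∙-·ˡ p ⁅ a ⁆ v) (cong (p ∧_) (⁅⁆-∙ a v))))

∙-concentrated : ∀ {n} (u w : Fin n → Bool) {a} → u a ≡ true → (∀ k → k ≢ a → u k ≡ true → w k ≡ false) → u ∙ w ≡ w a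
∙-concentrated u w {a} ua vanish = trans (Σ₂.sum-cong-≗ pointwise) (⁅⁆-∙ a w)
  where
  pointwise : ∀ k → u k ∧ w k ≡ ⁅ a ⁆ k ∧ w k
  pointwise k with ≡⊎≢ k a
  ... | inj₁ refl = trans (cong (_∧ w k) ua) (cong (_∧ w k) (sym (==-refl k)))
  ... | inj₂ k≢a with u k in uk
  ...   | false = cong (_∧ w k) (sym (==-≢ k≢a))
  ...   | true = trans (vanish k k≢a uk) (cong (_∧ w k) (sym (==-≢ k≢a)))

∙-congˡ : ∀ {n} {u u' : Fin n → Bool} (v : Fin n → Bool) → (∀ i → u i ≡ u' i) → u ∙ v ≡ u' ∙ v
∙-congˡ v h = Σ₂.sum-cong-≗ (λ i → cong (_∧ v i) (h i))

∙-agree : ∀ {n} (u : Fin n → Bool) {v v'} → (∀ i → u i ≡ true → v i ≡ v' i) → u ∙ v ≡ u ∙ v'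
∙-agree u {v} {v'} h = Σ₂.sum-cong-≗ pointwise
  where
  pointwise : ∀ i → u i ∧ v i ≡ u i ∧ v' i
  pointwise i with u i in ui
  ... | false = refl
  ... | true = h i ui

∙-punchIn : ∀ {n} (v : Fin (suc n)) (u w : Fin (suc n) → Bool) → u v ≡ false → u ∙ w ≡ (u ∘ punchIn v) ∙ (w ∘ punchIn v)
∙-punchIn v u w uv = trans (Σ₂.sum-remove {i = v} (λ i → u i ∧ w i)) (cong (λ x → (x ∧ w v) xor ((u ∘ punchIn v) ∙ (w ∘ punchIn v))) uv)

-- Independent rows and the rank

module _ (p : A → Bool) where

  all≡true⇒ : ∀ xs → all p xs ≡ true → ∀ {x} → x ∈ xs → p x ≡ true
  all≡true⇒ (y ∷ xs) h (here refl) with p y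
  ... | true = refl
  all≡true⇒ (y ∷ xs) h (there x∈) with p y
  ... | true = all≡true⇒ xs h x∈

  all≡true⇐ : ∀ xs → (∀ {x} → x ∈ xs → p x ≡ true) → all p xs ≡ true
  all≡true⇐ [] h = refl
  all≡true⇐ (y ∷ xs) h rewrite h (here refl) = all≡true⇐ xs (h ∘ there)

  all≡false⇒ : ∀ xs → all p xs ≡ false → ∃ λ x → x ∈ xs × p x ≡ false
  all≡false⇒ (y ∷ xs) h with p y in py
  ... | false = y , here refl , py
  ... | true = let (x , x∈ , px) = all≡false⇒ xs h in x , there x∈ , px

  any≡true⇒ : ∀ xs → any p xs ≡ true → ∃ λ x → x ∈ xs × p x ≡ true
  any≡true⇒ (y ∷ xs) h with p y in py
  ... | true = y , here refl , py
  ... | false = let (x , x∈ , px) = any≡true⇒ xs h in x , there x∈ , px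

  any≡true⇐ : ∀ xs {x} → x ∈ xs → p x ≡ true → any p xs ≡ true
  any≡true⇐ (y ∷ xs) (here refl) px rewrite px = refl
  any≡true⇐ (y ∷ xs) (there x∈) px with p y
  ... | true = refl
  ... | false = any≡true⇐ xs x∈ px

  any≡false⇒ : ∀ xs → any p xs ≡ false → ∀ {x} → x ∈ xs → p x ≡ false
  any≡false⇒ (y ∷ xs) h (here refl) with p y
  ... | false = refl
  any≡false⇒ (y ∷ xs) h (there x∈) with p y
  ... | false = any≡false⇒ xs h x∈

max-≥ : ∀ (f : A → ℕ) xs {x} → x ∈ xs → f x ≤ foldr _⊔_ 0 (map f xs)
max-≥ f (y ∷ xs) (here refl) = m≤m⊔n (f y) _
max-≥ f (y ∷ xs) (there x∈) = ≤-trans (max-≥ f xs x∈) (m≤n⊔m (f y) _)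

max-attained : ∀ (f : A → ℕ) xs →
  foldr _⊔_ 0 (map f xs) ≡ 0 ⊎ ∃ λ x → x ∈ xs × f x ≡ foldr _⊔_ 0 (map f xs)
max-attained f [] = inj₁ refl
max-attained f (y ∷ xs) with max-attained f xs | ⊔-sel (f y) (foldr _⊔_ 0 (map f xs))
... | _ | inj₁ y-max = inj₂ (y , here refl , sym y-max)
... | inj₁ zero-max | inj₂ rest-max = inj₁ (trans rest-max zero-max)
... | inj₂ (x , x∈ , fx) | inj₂ rest-max = inj₂ (x , there x∈ , trans fx (sym rest-max))

∈-subsets : ∀ {n} (U : Subset n) → U ∈ subsets n
∈-subsets [] = here refl
∈-subsets {suc n} (false ∷ U) = ∈-++⁺ˡ (∈-map⁺ (false ∷_) (∈-subsets U))
∈-subsets {suc n} (true ∷ U) = ∈-++⁺ʳ (map (false ∷_) (subsets n)) (∈-map⁺ (true ∷_) (∈-subsets U))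

_⊆_ : ∀ {n} → (Fin n → Bool) → (Fin n → Bool) → Set
u ⊆ t = ∀ i → u i ≡ true → t i ≡ true

Inhabited : ∀ {n} → (Fin n → Bool) → Set
Inhabited u = ∃ λ i → u i ≡ true

⊆-false : ∀ {n} {u t : Fin n → Bool} {v} → u ⊆ t → t v ≡ false → u v ≡ false
⊆-false {u = u} {v = v} u⊆t tv with u v in uv
... | false = refl
... | true = ⊥-elim (true≢false (trans (sym (u⊆t v uv)) tv))

⊆-punchIn : ∀ {n} (v : Fin (suc n)) {u t : Fin (suc n) → Bool} → u v ≡ false → (u ∘ punchIn v) ⊆ (t ∘ punchIn v) → u ⊆ t
⊆-punchIn v uv u⊆t k uk with ≡⊎punchIn v k
... | inj₁ refl = ⊥-elim (true≢false (trans (sym uk) uv))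
... | inj₂ (k' , refl) = u⊆t k' uk

Independent : ∀ {n} → Graph n → (s t : Fin n → Bool) → Set
Independent M s t = ∀ u → u ⊆ t → Inhabited u → ∃ λ j → s j ≡ true × u ∙ column M j ≡ true

Dependent : ∀ {n} → Graph n → (s t : Fin n → Bool) → Set
Dependent M s t = ∃ λ u → u ⊆ t × Inhabited u × (∀ j → s j ≡ true → u ∙ column M j ≡ false)

Independent-antitone : ∀ {n} (M : Graph n) s {t t'} → t' ⊆ t → Independent M s t → Independent M s t'
Independent-antitone M s t'⊆t ind u u⊆t' = ind u (λ i → t'⊆t i ∘ u⊆t' i)

Dependent-monotone : ∀ {n} (M : Graph n) s {t t'} → t ⊆ t' → Dependent M s t → Dependent M s t'
Dependent-monotone M s t⊆t' (u , u⊆t , u≠∅ , u-null) = u , (λ i → t⊆t' i ∘ u⊆t i) , u≠∅ , u-null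

⊆ᵇ⇒⊆ : ∀ {n} (U T : Subset n) → (U ⊆ᵇ T) ≡ true → lookup U ⊆ lookup T
⊆ᵇ⇒⊆ {n} U T h i = not∨-elim (all≡true⇒ _ (allFin n) h (∈-allFin i))

⊆⇒⊆ᵇ : ∀ {n} (U T : Subset n) → lookup U ⊆ lookup T → (U ⊆ᵇ T) ≡ true
⊆⇒⊆ᵇ {n} U T h = all≡true⇐ _ (allFin n) λ {i} _ → not∨-intro (h i)

nonEmpty⇒Inhabited : ∀ {n} (U : Subset n) → nonEmpty U ≡ true → Inhabited (lookup U)
nonEmpty⇒Inhabited {n} U h = let (i , _ , Ui) = any≡true⇒ _ (allFin n) h in i , Ui

Inhabited⇒nonEmpty : ∀ {n} (U : Subset n) → Inhabited (lookup U) → nonEmpty U ≡ true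
Inhabited⇒nonEmpty {n} U (i , Ui) = any≡true⇐ _ (allFin n) (∈-allFin i) Ui

independent⇒Independent : ∀ {n} (M : Graph n) S T → independent M S T ≡ true → Independent M (lookup S) (lookup T)
independent⇒Independent {n} M S T h u u⊆T (i , ui) =
  let (j , _ , Sj∧r) = any≡true⇒ _ (allFin n) (not∨-elim (all≡true⇒ _ (subsets n) h (∈-subsets U)) U-relevant)
      (Sj , r) = ∧≡true⇒ Sj∧r
  in j , Sj , trans (sym (trans (rowSum≡∙ M U j) (∙-congˡ (column M j) U≗u))) r
  where
  U = tabulate u
  U≗u = lookup∘tabulate u
  U-relevant : (U ⊆ᵇ T) ∧ nonEmpty U ≡ true
  U-relevant = ∧≡true⇐ (⊆⇒⊆ᵇ U T (λ k Uk → u⊆T k (trans (sym (U≗u k)) Uk)))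
                       (Inhabited⇒nonEmpty U (i , trans (U≗u i) ui))

Independent⇒independent : ∀ {n} (M : Graph n) S T → Independent M (lookup S) (lookup T) → independent M S T ≡ true
Independent⇒independent {n} M S T ind = all≡true⇐ _ (subsets n) λ {U} _ → not∨-intro λ relevant →
  let (U⊆ᵇT , U≠∅) = ∧≡true⇒ {U ⊆ᵇ T} relevant
      (j , Sj , r) = ind (lookup U) (⊆ᵇ⇒⊆ U T U⊆ᵇT) (nonEmpty⇒Inhabited U U≠∅)
  in any≡true⇐ _ (allFin n) (∈-allFin j) (∧≡true⇐ Sj (trans (rowSum≡∙ M U j) r))

independent≡false⇒Dependent : ∀ {n} (M : Graph n) S T → independent M S T ≡ false → Dependent M (lookup S) (lookup T)
independent≡false⇒Dependent {n} M S T h with all≡false⇒ _ (subsets n) h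
... | U , _ , fails with (U ⊆ᵇ T) in U⊆ᵇT | nonEmpty U in U≠∅
... | true | true = lookup U , ⊆ᵇ⇒⊆ U T U⊆ᵇT , nonEmpty⇒Inhabited U U≠∅ ,
      λ j Sj → trans (sym (rowSum≡∙ M U j)) (∧-false Sj (any≡false⇒ _ (allFin n) fails (∈-allFin j)))
  where
  ∧-false : ∀ {x y} → x ≡ true → x ∧ y ≡ false → y ≡ false
  ∧-false refl h = h

Independent⊎Dependent : ∀ {n} (M : Graph n) S t → Independent M (lookup S) t ⊎ Dependent M (lookup S) t
Independent⊎Dependent M S t with independent M S (tabulate t) in eq
... | true = inj₁ (Independent-antitone M (lookup S) (λ i ti → trans (lookup∘tabulate t i) ti)
                     (independent⇒Independent M S (tabulate t) eq))
... | false = inj₂ (Dependent-monotone M (lookup S) (λ i Ti → trans (sym (lookup∘tabulate t i)) Ti)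
                     (independent≡false⇒Dependent M S (tabulate t) eq))

Independent-∅ : ∀ {n} (M : Graph n) s → Independent M s ∅
Independent-∅ M s u u⊆∅ (i , ui) with u⊆∅ i ui
... | ()

rankCandidate : ∀ {n} → Graph n → Subset n → Subset n → ℕ
rankCandidate M S T = if (T ⊆ᵇ S) ∧ independent M S T then card T else 0

rankOn-≥ : ∀ {n} (M : Graph n) S t → t ⊆ lookup S → Independent M (lookup S) t → count t ≤ rankOn M S
rankOn-≥ {n} M S t t⊆S ind = ≤-trans (≤-reflexive count≡rankCandidate) (max-≥ (rankCandidate M S) (subsets n) (∈-subsets T))
  where
  T = tabulate t
  T⊆t : lookup T ⊆ t
  T⊆t i Ti = trans (sym (lookup∘tabulate t i)) Ti
  count≡rankCandidate : count t ≡ rankCandidate M S T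
  count≡rankCandidate
    rewrite ⊆⇒⊆ᵇ T S (λ i → t⊆S i ∘ T⊆t i)
          | Independent⇒independent M S T (Independent-antitone M (lookup S) T⊆t ind)
    = trans (count-cong (λ i → sym (lookup∘tabulate t i))) (sym (card≡count T))

rankOn-attained : ∀ {n} (M : Graph n) S → ∃ λ t → t ⊆ lookup S × Independent M (lookup S) t × count t ≡ rankOn M S
rankOn-attained {n} M S with max-attained (rankCandidate M S) (subsets n)
... | inj₁ rank≡0 = ∅ , (λ _ ()) , Independent-∅ M (lookup S) , trans (count-∅ n) (sym rank≡0)
... | inj₂ (T , _ , attained) with (T ⊆ᵇ S) in T⊆ᵇS | independent M S T in indT
...   | true | true = lookup T , ⊆ᵇ⇒⊆ T S T⊆ᵇS , independent⇒Independent M S T indT , trans (sym (card≡count T)) attained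
...   | true | false = ∅ , (λ _ ()) , Independent-∅ M (lookup S) , trans (count-∅ n) attained
...   | false | _ = ∅ , (λ _ ()) , Independent-∅ M (lookup S) , trans (count-∅ n) attained

rankOn-transfer : ∀ {n n'} (M : Graph n) S (M' : Graph n') S' d e →
  (∀ t → t ⊆ lookup S → Independent M (lookup S) t →
     ∃ λ t' → t' ⊆ lookup S' × Independent M' (lookup S') t' × count t + d ≤ count t' + e) →
  rankOn M S + d ≤ rankOn M' S' + e
rankOn-transfer M S M' S' d e extend with rankOn-attained M S
... | t , t⊆S , ind , attained with extend t t⊆S ind
... | t' , t'⊆S' , ind' , le rewrite sym attained =
  ≤-trans le (ℕₚ.+-monoˡ-≤ e (rankOn-≥ M' S' t' t'⊆S' ind'))

rankOn-≤ : ∀ {n n'} (M : Graph n) S (M' : Graph n') S' →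
  (∀ t → t ⊆ lookup S → Independent M (lookup S) t →
     ∃ λ t' → t' ⊆ lookup S' × Independent M' (lookup S') t' × count t ≡ count t') →
  rankOn M S ≤ rankOn M' S'
rankOn-≤ M S M' S' extend =
  subst₂ _≤_ (ℕₚ.+-identityʳ _) (ℕₚ.+-identityʳ _) (rankOn-transfer M S M' S' 0 0 λ t t⊆S ind →
    let (t' , t'⊆S' , ind' , eq) = extend t t⊆S ind in t' , t'⊆S' , ind' , ≤-reflexive (cong (_+ 0) eq))

rankOn-mono : ∀ {n} (M M' : Graph n) S →
  (∀ t → t ⊆ lookup S → Independent M (lookup S) t → Independent M' (lookup S) t) → rankOn M S ≤ rankOn M' S
rankOn-mono M M' S preserve = rankOn-≤ M S M' S λ t t⊆S ind → t , t⊆S , preserve t t⊆S ind , refl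

rankOn-≡ : ∀ {n} (M M' : Graph n) S →
  (∀ t → t ⊆ lookup S → Independent M (lookup S) t → Independent M' (lookup S) t) →
  (∀ t → t ⊆ lookup S → Independent M' (lookup S) t → Independent M (lookup S) t) →
  rankOn M S ≡ rankOn M' S
rankOn-≡ M M' S to from = ≤-antisym (rankOn-mono M M' S to) (rankOn-mono M' M S from)

-- Row and column operations

Independent-cong : ∀ {n} {M M' : Graph n} s t → (∀ i j → t i ≡ true → s j ≡ true → M i j ≡ M' i j) →
  Independent M s t → Independent M' s t
Independent-cong s t agree ind u u⊆t u≠∅ =
  let (j , sj , r) = ind u u⊆t u≠∅ in j , sj , trans (∙-agree u (λ i ui → sym (agree i j (u⊆t i ui) sj))) r

rankOn-cong : ∀ {n} (M M' : Graph n) S → (∀ i j → lookup S i ≡ true → lookup S j ≡ true → M i j ≡ M' i j) →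
  rankOn M S ≡ rankOn M' S
rankOn-cong M M' S agree = rankOn-≡ M M' S
  (λ t t⊆S → Independent-cong (lookup S) t λ i j ti Sj → agree i j (t⊆S i ti) Sj)
  (λ t t⊆S → Independent-cong (lookup S) t λ i j ti Sj → sym (agree i j (t⊆S i ti) Sj))

colOp : ∀ {n} → Graph n → Fin n → (Fin n → Bool) → Graph n
colOp M a c i j = M i j xor (c j ∧ M i a)

colOp-involutive : ∀ {n} (M : Graph n) a c → c a ≡ false → ∀ i j → colOp (colOp M a c) a c i j ≡ M i j
colOp-involutive M a c ca i j rewrite ca | xor-identityʳ (M i a) = xor-cancel (M i j) (c j ∧ M i a)

∙-colOp : ∀ {n} (M : Graph n) a c u j →
  u ∙ column (colOp M a c) j ≡ (u ∙ column M j) xor (c j ∧ (u ∙ column M a))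
∙-colOp M a c u j = trans (∙-⊕ʳ u (column M j) _) (cong ((u ∙ column M j) xor_) (∙-·ʳ (c j) u (column M a)))

Independent-colOp : ∀ {n} (M : Graph n) a c s t → c a ≡ false → s a ≡ true →
  Independent M s t → Independent (colOp M a c) s t
Independent-colOp M a c s t ca sa ind u u⊆t u≠∅ with u ∙ column M a in ua
... | true = a , sa , trans (∙-colOp M a c u a) (cong₂ (λ x y → x xor (y ∧ x)) ua ca)
... | false = let (j , sj , r) = ind u u⊆t u≠∅ in
  j , sj , trans (∙-colOp M a c u j) (trans (cong₂ (λ x y → x xor (c j ∧ y)) r ua) (cong (true xor_) (∧-zeroʳ (c j))))

rankOn-colOp : ∀ {n} (M : Graph n) a c S → c a ≡ false → lookup S a ≡ true → rankOn (colOp M a c) S ≡ rankOn M S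
rankOn-colOp M a c S ca Sa = rankOn-≡ (colOp M a c) M S
  (λ t _ ind → Independent-cong (lookup S) t (λ i j _ _ → colOp-involutive M a c ca i j)
                 (Independent-colOp (colOp M a c) a c (lookup S) t ca Sa ind))
  (λ t _ → Independent-colOp M a c (lookup S) t ca Sa)

rowOp : ∀ {n} → Graph n → Fin n → (Fin n → Bool) → Graph n
rowOp M a c i j = M i j xor (M a j ∧ c i)

rowOp-involutive : ∀ {n} (M : Graph n) a c → c a ≡ false → ∀ i j → rowOp (rowOp M a c) a c i j ≡ M i j
rowOp-involutive M a c ca i j rewrite ca | ∧-zeroʳ (M a j) | xor-identityʳ (M a j) = xor-cancel (M i j) (M a j ∧ c i)

∙-rowOp : ∀ {n} (M : Graph n) a c u j →
  u ∙ column (rowOp M a c) j ≡ (u ∙ column M j) xor (M a j ∧ (u ∙ c))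
∙-rowOp M a c u j = trans (∙-⊕ʳ u (column M j) _) (cong ((u ∙ column M j) xor_) (∙-·ʳ (M a j) u c))

Independent-rowOp-∋ : ∀ {n} (M : Graph n) a c s t → c a ≡ false → t a ≡ true →
  Independent M s t → Independent (rowOp M a c) s t
Independent-rowOp-∋ M a c s t ca ta ind u u⊆t u≠∅ =
  let (j , sj , r) = ind u' u'⊆t u'≠∅ in j , sj , trans (∙-rowOp M a c u j) (trans (rearranged j) r)
  where
  u' = u ⊕ ((u ∙ c) · ⁅ a ⁆)
  rearranged : ∀ j → (u ∙ column M j) xor (M a j ∧ (u ∙ c)) ≡ u' ∙ column M j
  rearranged j = trans (cong ((u ∙ column M j) xor_) (∧-comm (M a j) (u ∙ c))) (sym (∙-toggle u (u ∙ c) a (column M j)))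
  u'⊆t : u' ⊆ t
  u'⊆t k u'k with ≡⊎≢ k a
  ... | inj₁ refl = ta
  ... | inj₂ k≢a = u⊆t k (trans (sym (toggle-there u (u ∙ c) k≢a)) u'k)
  u'≠∅ : Inhabited u'
  u'≠∅ with u ∙ c in u∙c
  ... | false = let (k , uk) = u≠∅ in
    k , trans (xor-identityʳ (u k)) uk
  ... | true = let (i , ui , ci) = ∙≡true⇒ u c u∙c in
    i , trans (toggle-there u true (true-false⇒≢ c ci ca)) ui

-- Exchange step: if the rows t stop being independent after the row operation, swapping a
-- suitable row i of t for row a restores independence.
module RowExchange {n} (M : Graph n) (a : Fin n) (c : Fin n → Bool) (ca : c a ≡ false)
  (s t : Fin n → Bool) (t⊆s : t ⊆ s) (sa : s a ≡ true) (ta : t a ≡ false) (ind : Independent M s t)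
  (u : Fin n → Bool) (u⊆t : u ⊆ t) (u≠∅ : Inhabited u)
  (u-null : ∀ j → s j ≡ true → u ∙ column (rowOp M a c) j ≡ false) where

  u∙c : u ∙ c ≡ true
  u∙c with u ∙ c in eq
  ... | true = refl
  ... | false = let (j , sj , r) = ind u u⊆t u≠∅ in
    ⊥-elim (true≢false (begin
      true                                        ≡⟨ cong (λ p → true xor (M a j ∧ p)) eq ⟨ trans ⟩ cong (true xor_) (∧-zeroʳ (M a j)) ⟨
      true xor (M a j ∧ (u ∙ c))                  ≡⟨ cong (λ x → x xor (M a j ∧ (u ∙ c))) r ⟨
      (u ∙ column M j) xor (M a j ∧ (u ∙ c))      ≡⟨ ∙-rowOp M a c u j ⟨
      u ∙ column (rowOp M a c) j                  ≡⟨ u-null j sj ⟩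
      false                                       ∎))
    where open ≡-Reasoning

  u-row-a : ∀ j → s j ≡ true → u ∙ column M j ≡ M a j
  u-row-a j sj = xor≡false⇒ (u ∙ column M j) (begin
    (u ∙ column M j) xor M a j
      ≡⟨ cong (λ p → (u ∙ column M j) xor (M a j ∧ p)) u∙c ⟨ trans ⟩ cong ((u ∙ column M j) xor_) (∧-identityʳ (M a j)) ⟨
    (u ∙ column M j) xor (M a j ∧ (u ∙ c))      ≡⟨ ∙-rowOp M a c u j ⟨
    u ∙ column (rowOp M a c) j                  ≡⟨ u-null j sj ⟩
    false                                       ∎)
    where open ≡-Reasoning

  i : Fin n
  i = let (i , _ , _) = ∙≡true⇒ u c u∙c in i

  ui : u i ≡ true
  ui = let (_ , ui , _) = ∙≡true⇒ u c u∙c in ui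

  i≢a : i ≢ a
  i≢a = let (_ , _ , ci) = ∙≡true⇒ u c u∙c in true-false⇒≢ c ci ca

  ti : t i ≡ true
  ti = u⊆t i ui

  ua : u a ≡ false
  ua with u a in eq
  ... | false = refl
  ... | true = ⊥-elim (true≢false (trans (sym (u⊆t a eq)) ta))

  t' : Fin n → Bool
  t' = (t ⊕ (true · ⁅ i ⁆)) ⊕ (true · ⁅ a ⁆)

  t'-there : ∀ k → k ≢ i → k ≢ a → t' k ≡ t k
  t'-there k k≢i k≢a = trans (toggle-there (t ⊕ (true · ⁅ i ⁆)) true k≢a) (toggle-there t true k≢i)

  t'-i : t' i ≡ false
  t'-i = trans (toggle-there (t ⊕ (true · ⁅ i ⁆)) true i≢a) (trans (toggle-here t true i) (cong (_xor true) ti))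

  t'-a : t' a ≡ true
  t'-a = trans (toggle-here (t ⊕ (true · ⁅ i ⁆)) true a) (cong (_xor true) (trans (toggle-there t true (i≢a ∘ sym)) ta))

  t'⊆s : t' ⊆ s
  t'⊆s k t'k with ≡⊎≢ k a | ≡⊎≢ k i
  ... | inj₁ refl | _ = sa
  ... | inj₂ _ | inj₁ refl = ⊥-elim (true≢false (trans (sym t'k) t'-i))
  ... | inj₂ k≢a | inj₂ k≢i = t⊆s k (trans (sym (t'-there k k≢i k≢a)) t'k)

  count-t' : count t' ≡ count t
  count-t' = ℕₚ.+-cancelʳ-≡ 1 (count t') (count t) (begin
    count t' + 1                          ≡⟨ cong₂ (λ x y → count t' + (bit x + bit y)) ti ta ⟨
    count t' + (bit (t i) + bit (t a))    ≡⟨ count-agree-off₂ t' t i≢a (λ k k≢i k≢a → t'-there k k≢i k≢a) ⟩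
    count t + (bit (t' i) + bit (t' a))   ≡⟨ cong₂ (λ x y → count t + (bit x + bit y)) t'-i t'-a ⟩
    count t + 1                           ∎)
    where open ≡-Reasoning

  -- w writes the combination of the new rows v ⊆ t' as a combination of old rows.
  module _ (v : Fin n → Bool) (v⊆t' : v ⊆ t') where

    ε : Bool
    ε = v a xor (v ∙ c)

    w : Fin n → Bool
    w = (v ⊕ (v a · ⁅ a ⁆)) ⊕ (ε · u)

    vi : v i ≡ false
    vi with v i in eq
    ... | false = refl
    ... | true = ⊥-elim (true≢false (trans (sym (v⊆t' i eq)) t'-i))

    w-there : ∀ {k} → k ≢ a → w k ≡ v k xor (ε ∧ u k)
    w-there {k} k≢a = cong (_xor (ε ∧ u k)) (toggle-there v (v a) k≢a)

    w∙ : ∀ j → s j ≡ true → w ∙ column M j ≡ v ∙ column (rowOp M a c) j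
    w∙ j sj = begin
      w ∙ column M j
        ≡⟨ ∙-⊕ˡ _ (ε · u) (column M j) ⟩
      ((v ⊕ (v a · ⁅ a ⁆)) ∙ column M j) xor ((ε · u) ∙ column M j)
        ≡⟨ cong₂ _xor_ (∙-toggle v (v a) a (column M j)) (trans (∙-·ˡ ε u (column M j)) (cong (ε ∧_) (u-row-a j sj))) ⟩
      ((v ∙ column M j) xor (v a ∧ M a j)) xor (ε ∧ M a j)
        ≡⟨ cancel (v ∙ column M j) (v a) (v ∙ c) (M a j) ⟩
      (v ∙ column M j) xor (M a j ∧ (v ∙ c))
        ≡⟨ ∙-rowOp M a c v j ⟨
      v ∙ column (rowOp M a c) j ∎
      where
      open ≡-Reasoning
      -- The solver works in arbitrary commutative rings, so y ⊕ y = 0 is applied separately.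
      distribute : ∀ x p q m → (x xor (p ∧ m)) xor ((p xor q) ∧ m) ≡ x xor (((p ∧ m) xor (p ∧ m)) xor (m ∧ q))
      distribute = Reflective.solve-∀ GF₂
      cancel : ∀ x p q m → (x xor (p ∧ m)) xor ((p xor q) ∧ m) ≡ x xor (m ∧ q)
      cancel x p q m = trans (distribute x p q m) (cong (λ y → x xor (y xor (m ∧ q))) (xor-same (p ∧ m)))

    w⊆t : w ⊆ t
    w⊆t k wk with ≡⊎≢ k a
    ... | inj₁ refl = ⊥-elim (true≢false (trans (sym wk) w-a))
      where
      w-a : w a ≡ false
      w-a = cong₂ _xor_ (trans (toggle-here v (v a) a) (xor-same (v a))) (cong (ε ∧_) ua ⟨ trans ⟩ ∧-zeroʳ ε)
    ... | inj₂ k≢a with xor≡true⇒ (v k) (trans (sym (w-there k≢a)) wk)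
    ...   | inj₂ εuk = u⊆t k (proj₂ (∧≡true⇒ {ε} εuk))
    ...   | inj₁ vk with ≡⊎≢ k i
    ...     | inj₁ refl = ⊥-elim (true≢false (trans (sym vk) vi))
    ...     | inj₂ k≢i = trans (sym (t'-there k k≢i k≢a)) (v⊆t' k vk)

    w≠∅ : Inhabited v → Inhabited w
    w≠∅ (k , vk) with ≡true⊎≡false ε
    ... | inj₁ ε≡ = i , trans (w-there i≢a) (cong₂ (λ x y → x xor (y ∧ u i)) vi ε≡ ⟨ trans ⟩ ui)
    ... | inj₂ ε≡ with ≡⊎≢ k a
    ...   | inj₂ k≢a = k , trans (w-there k≢a) (trans (cong (λ e → v k xor (e ∧ u k)) ε≡) (trans (xor-identityʳ (v k)) vk))
    ...   | inj₁ refl =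
      let (l , vl , cl) = ∙≡true⇒ v c (trans (sym (xor≡false⇒ (v a) ε≡)) vk)
      in l , trans (w-there (true-false⇒≢ c cl ca)) (trans (cong (λ e → v l xor (e ∧ u l)) ε≡) (trans (xor-identityʳ (v l)) vl))

  Independent-t' : Independent (rowOp M a c) s t'
  Independent-t' v v⊆t' v≠∅ =
    let (j , sj , r) = ind (w v v⊆t') (w⊆t v v⊆t') (w≠∅ v v⊆t' v≠∅) in j , sj , trans (sym (w∙ v v⊆t' j sj)) r

Independent-rowOp : ∀ {n} (M : Graph n) a c S t → c a ≡ false → lookup S a ≡ true →
  t ⊆ lookup S → Independent M (lookup S) t →
  ∃ λ t' → t' ⊆ lookup S × Independent (rowOp M a c) (lookup S) t' × count t ≡ count t'
Independent-rowOp M a c S t ca Sa t⊆S ind with ≡true⊎≡false (t a)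
... | inj₁ ta = t , t⊆S , Independent-rowOp-∋ M a c (lookup S) t ca ta ind , refl
... | inj₂ ta with Independent⊎Dependent (rowOp M a c) S t
...   | inj₁ ind' = t , t⊆S , ind' , refl
...   | inj₂ (u , u⊆t , u≠∅ , u-null) = t' , t'⊆s , Independent-t' , sym count-t'
  where open RowExchange M a c ca (lookup S) t t⊆S Sa ta ind u u⊆t u≠∅ u-null

rankOn-rowOp : ∀ {n} (M : Graph n) a c S → c a ≡ false → lookup S a ≡ true → rankOn (rowOp M a c) S ≡ rankOn M S
rankOn-rowOp M a c S ca Sa = ≤-antisym
  (rankOn-≤ (rowOp M a c) S M S λ t t⊆S ind →
    let (t' , t'⊆S , ind' , eq) = Independent-rowOp (rowOp M a c) a c S t ca Sa t⊆S ind
    in t' , t'⊆S , Independent-cong (lookup S) t' (λ i j _ _ → rowOp-involutive M a c ca i j) ind' , eq)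
  (rankOn-≤ M S (rowOp M a c) S λ t t⊆S → Independent-rowOp M a c S t ca Sa t⊆S)

Independent-delete : ∀ {m} (G : Graph (suc m)) v {s s'} → s v ≡ false → (∀ i → s (punchIn v i) ≡ s' i) →
  ∀ t → Independent G s t → Independent (delete v G) s' (t ∘ punchIn v)
Independent-delete G v {s} {s'} sv s∘punchIn t ind u' u'⊆t (k , u'k)
  with ind u (⊆-punchIn v {t = t} uv λ k uk → u'⊆t k (trans (sym (insertAtᶠ-punchIn u' v false k)) uk))
             (punchIn v k , trans (insertAtᶠ-punchIn u' v false k) u'k)
  where
  u = Vector.insertAt u' v false
  uv = insertAtᶠ-lookup u' v false
... | j , sj , r with ≡⊎punchIn v j
...   | inj₁ refl = ⊥-elim (true≢false (trans (sym sj) sv))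
...   | inj₂ (j' , refl) = j' , trans (sym (s∘punchIn j')) sj , (begin
  u' ∙ column (delete v G) j'                                ≡⟨ ∙-congˡ (column (delete v G) j') (insertAtᶠ-punchIn u' v false) ⟨
  (Vector.insertAt u' v false ∘ punchIn v) ∙ column (delete v G) j'
    ≡⟨ ∙-punchIn v (Vector.insertAt u' v false) (column G (punchIn v j')) (insertAtᶠ-lookup u' v false) ⟨
  Vector.insertAt u' v false ∙ column G (punchIn v j')       ≡⟨ r ⟩
  true                                                       ∎)
  where open ≡-Reasoning

Independent-undelete : ∀ {m} (G : Graph (suc m)) v {s s'} → (∀ i → s (punchIn v i) ≡ s' i) →
  ∀ t' → Independent (delete v G) s' t' → Independent G s (Vector.insertAt t' v false)
Independent-undelete G v s∘punchIn t' ind' u u⊆t (k , uk) =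
  let (j' , s'j' , r) = ind' (u ∘ punchIn v) (λ k uk → trans (sym (insertAtᶠ-punchIn t' v false k)) (u⊆t _ uk)) inhabited
  in punchIn v j' , trans (s∘punchIn j') s'j' , trans (∙-punchIn v u (column G (punchIn v j')) uv) r
  where
  uv = ⊆-false u⊆t (insertAtᶠ-lookup t' v false)
  inhabited : Inhabited (u ∘ punchIn v)
  inhabited with ≡⊎punchIn v k
  ... | inj₁ refl = ⊥-elim (true≢false (trans (sym uk) uv))
  ... | inj₂ (k' , refl) = k' , uk

rankOn-delete : ∀ {m} (G : Graph (suc m)) v S S' → lookup S v ≡ false → (∀ i → lookup S (punchIn v i) ≡ lookup S' i) →
  rankOn G S ≡ rankOn (delete v G) S'
rankOn-delete G v S S' Sv S∘punchIn = ≤-antisym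
  (rankOn-≤ G S (delete v G) S' λ t t⊆S ind →
     t ∘ punchIn v , (λ k tk → trans (sym (S∘punchIn k)) (t⊆S _ tk)) , Independent-delete G v Sv S∘punchIn t ind ,
     trans (count-remove v t) (cong (λ x → bit x + count (t ∘ punchIn v)) (⊆-false t⊆S Sv)))
  (rankOn-≤ (delete v G) S' G S λ t' t'⊆S' ind' →
     Vector.insertAt t' v false ,
     ⊆-punchIn v (insertAtᶠ-lookup t' v false) (λ k tk → trans (S∘punchIn k) (t'⊆S' k (trans (sym (insertAtᶠ-punchIn t' v false k)) tk))) ,
     Independent-undelete G v S∘punchIn t' ind' ,
     sym (trans (count-remove v (Vector.insertAt t' v false))
                (cong₂ (λ x y → bit x + y) (insertAtᶠ-lookup t' v false) (count-cong (insertAtᶠ-punchIn t' v false)))))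

module Block {n} (N : Graph n) {a b : Fin n} (S S₀ : Subset n) (a≢b : a ≢ b)
  (Sa : lookup S a ≡ true) (Sb : lookup S b ≡ true) (S₀a : lookup S₀ a ≡ false) (S₀b : lookup S₀ b ≡ false)
  (S₀-there : ∀ k → k ≢ a → k ≢ b → lookup S₀ k ≡ lookup S k)
  (Nab : N a b ≡ true) (Nba : N b a ≡ true) (Nbb : N b b ≡ false)
  (S₀-null : ∀ k → lookup S₀ k ≡ true → N k a ≡ false × N k b ≡ false) where

  S₀⊆S : lookup S₀ ⊆ lookup S
  S₀⊆S k S₀k with ≡⊎≢ k a | ≡⊎≢ k b
  ... | inj₁ refl | _ = Sa
  ... | inj₂ _ | inj₁ refl = Sb
  ... | inj₂ k≢a | inj₂ k≢b = trans (sym (S₀-there k k≢a k≢b)) S₀k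

  module _ (t₀ : Fin n → Bool) (t₀⊆S₀ : t₀ ⊆ lookup S₀) where

    t₁ : Fin n → Bool
    t₁ = (t₀ ⊕ (true · ⁅ a ⁆)) ⊕ (true · ⁅ b ⁆)

    t₁-there : ∀ k → k ≢ a → k ≢ b → t₁ k ≡ t₀ k
    t₁-there k k≢a k≢b = trans (toggle-there (t₀ ⊕ (true · ⁅ a ⁆)) true k≢b) (toggle-there t₀ true k≢a)

    t₁-a : t₁ a ≡ true
    t₁-a = trans (toggle-there (t₀ ⊕ (true · ⁅ a ⁆)) true a≢b)
                 (trans (toggle-here t₀ true a) (cong (_xor true) (⊆-false t₀⊆S₀ S₀a)))

    t₁-b : t₁ b ≡ true
    t₁-b = trans (toggle-here (t₀ ⊕ (true · ⁅ a ⁆)) true b)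
                 (cong (_xor true) (trans (toggle-there t₀ true (a≢b ∘ sym)) (⊆-false t₀⊆S₀ S₀b)))

    t₁⊆S : t₁ ⊆ lookup S
    t₁⊆S k t₁k with ≡⊎≢ k a | ≡⊎≢ k b
    ... | inj₁ refl | _ = Sa
    ... | inj₂ _ | inj₁ refl = Sb
    ... | inj₂ k≢a | inj₂ k≢b = S₀⊆S k (t₀⊆S₀ k (trans (sym (t₁-there k k≢a k≢b)) t₁k))

    count-t₁ : count t₀ + 2 ≡ count t₁ + 0
    count-t₁ = begin
      count t₀ + 2                             ≡⟨ cong₂ (λ x y → count t₀ + (bit x + bit y)) t₁-a t₁-b ⟨
      count t₀ + (bit (t₁ a) + bit (t₁ b))     ≡⟨ count-agree-off₂ t₀ t₁ a≢b (λ k k≢a k≢b → sym (t₁-there k k≢a k≢b)) ⟩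
      count t₁ + (bit (t₀ a) + bit (t₀ b))
        ≡⟨ cong₂ (λ x y → count t₁ + (bit x + bit y)) (⊆-false t₀⊆S₀ S₀a) (⊆-false t₀⊆S₀ S₀b) ⟩
      count t₁ + 0                             ∎
      where open ≡-Reasoning

    -- A combination of rows of t₁ involving row a is nonzero in column b, and one involving row b
    -- but not row a is nonzero in column a.
    Independent-t₁ : Independent N (lookup S₀) t₀ → Independent N (lookup S) t₁
    Independent-t₁ ind₀ u u⊆t₁ u≠∅ with ≡true⊎≡false (u a) | ≡true⊎≡false (u b)
    ... | inj₁ ua | _ = b , Sb , trans (∙-concentrated u (column N b) ua vanish) Nab
      where
      vanish : ∀ k → k ≢ a → u k ≡ true → N k b ≡ false
      vanish k k≢a uk with ≡⊎≢ k b
      ... | inj₁ refl = Nbb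
      ... | inj₂ k≢b = proj₂ (S₀-null k (t₀⊆S₀ k (trans (sym (t₁-there k k≢a k≢b)) (u⊆t₁ k uk))))
    ... | inj₂ ua | inj₁ ub = a , Sa , trans (∙-concentrated u (column N a) ub vanish) Nba
      where
      vanish : ∀ k → k ≢ b → u k ≡ true → N k a ≡ false
      vanish k k≢b uk with ≡⊎≢ k a
      ... | inj₁ refl = ⊥-elim (true≢false (trans (sym uk) ua))
      ... | inj₂ k≢a = proj₁ (S₀-null k (t₀⊆S₀ k (trans (sym (t₁-there k k≢a k≢b)) (u⊆t₁ k uk))))
    ... | inj₂ ua | inj₂ ub =
      let (j , S₀j , r) = ind₀ u u⊆t₀ u≠∅ in j , S₀⊆S j S₀j , r
      where
      u⊆t₀ : u ⊆ t₀
      u⊆t₀ k uk = trans (sym (t₁-there k (true-false⇒≢ u uk ua) (true-false⇒≢ u uk ub))) (u⊆t₁ k uk)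

  module _ (t₁ : Fin n → Bool) (t₁⊆S : t₁ ⊆ lookup S) where

    t₀ : Fin n → Bool
    t₀ k = t₁ k ∧ lookup S₀ k

    t₀⊆S₀ : t₀ ⊆ lookup S₀
    t₀⊆S₀ k t₀k = proj₂ (∧≡true⇒ {t₁ k} t₀k)

    count-t₀ : count t₁ + 0 ≤ count t₀ + 2
    count-t₀ = begin
      count t₁ + 0
        ≡⟨ cong₂ (λ x y → count t₁ + (bit x + bit y)) (t₀-off S₀a) (t₀-off S₀b) ⟨
      count t₁ + (bit (t₀ a) + bit (t₀ b))     ≡⟨ count-agree-off₂ t₁ t₀ a≢b agree ⟩
      count t₀ + (bit (t₁ a) + bit (t₁ b))     ≤⟨ ℕₚ.+-monoʳ-≤ (count t₀) (ℕₚ.+-mono-≤ (bit≤1 (t₁ a)) (bit≤1 (t₁ b))) ⟩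
      count t₀ + 2                             ∎
      where
      open ≤-Reasoning
      t₀-off : ∀ {k} → lookup S₀ k ≡ false → t₀ k ≡ false
      t₀-off {k} S₀k = cong (t₁ k ∧_) S₀k ⟨ trans ⟩ ∧-zeroʳ (t₁ k)
      agree : ∀ k → k ≢ a → k ≢ b → t₁ k ≡ t₀ k
      agree k k≢a k≢b with t₁ k in t₁k
      ... | false = refl
      ... | true = sym (trans (S₀-there k k≢a k≢b) (t₁⊆S k t₁k))

    Independent-t₀ : Independent N (lookup S) t₁ → Independent N (lookup S₀) t₀
    Independent-t₀ ind₁ u u⊆t₀ u≠∅ =
      let (j , Sj , r) = ind₁ u (λ k uk → proj₁ (∧≡true⇒ {t₁ k} (u⊆t₀ k uk))) u≠∅
      in j , trans (S₀-there j (j≢ a proj₁ r) (j≢ b proj₂ r)) Sj , r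
      where
      j≢ : ∀ {j} c → (∀ {k} → N k a ≡ false × N k b ≡ false → N k c ≡ false) → u ∙ column N j ≡ true → j ≢ c
      j≢ c select r refl = true≢false (trans (sym r) (∙-disjoint u (column N c) λ k uk → select (S₀-null k (t₀⊆S₀ k (u⊆t₀ k uk)))))

  rankOn-block : rankOn N S ≡ 2 + rankOn N S₀
  rankOn-block = ≤-antisym
    (subst₂ _≤_ (ℕₚ.+-identityʳ _) (ℕₚ.+-comm (rankOn N S₀) 2)
      (rankOn-transfer N S N S₀ 0 2 λ t₁ t₁⊆S ind₁ →
        t₀ t₁ t₁⊆S , t₀⊆S₀ t₁ t₁⊆S , Independent-t₀ t₁ t₁⊆S ind₁ , count-t₀ t₁ t₁⊆S))
    (subst₂ _≤_ (ℕₚ.+-comm (rankOn N S₀) 2) (ℕₚ.+-identityʳ _)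
      (rankOn-transfer N S₀ N S 2 0 λ t₀ t₀⊆S₀ ind₀ →
        t₁ t₀ t₀⊆S₀ , t₁⊆S t₀ t₀⊆S₀ , Independent-t₁ t₀ t₀⊆S₀ ind₀ , ≤-reflexive (count-t₁ t₀ t₀⊆S₀)))

-- Pivoting

xor-regroup : ∀ x p q r s → (x xor (s ∧ r)) xor (q ∧ p) ≡ x xor ((p ∧ q) xor (r ∧ s))
xor-regroup = Reflective.solve-∀ GF₂

toggle-condition : ∀ p q r s → (p ∧ q ∧ (not r ∨ not s)) ∨ (s ∧ r ∧ (not q ∨ not p)) ≡ (p ∧ q) xor (r ∧ s)
toggle-condition false false false false = refl
toggle-condition false false false true  = refl
toggle-condition false false true  false = refl
toggle-condition false false true  true  = refl
toggle-condition false true  false false = refl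
toggle-condition false true  false true  = refl
toggle-condition false true  true  false = refl
toggle-condition false true  true  true  = refl
toggle-condition true  false false false = refl
toggle-condition true  false false true  = refl
toggle-condition true  false true  false = refl
toggle-condition true  false true  true  = refl
toggle-condition true  true  false false = refl
toggle-condition true  true  false true  = refl
toggle-condition true  true  true  false = refl
toggle-condition true  true  true  true  = refl

module _ {n} (G : Graph n) (a b : Fin n) where

  pivot-inside : ∀ {u w} → u ≢ a → u ≢ b → w ≢ a → w ≢ b → u ≢ w →
    pivot G a b u w ≡ G u w xor ((G u a ∧ G w b) xor (G u b ∧ G w a))
  pivot-inside {u} {w} u≢a u≢b w≢a w≢b u≢w
    rewrite ==-≢ u≢a | ==-≢ u≢b | ==-≢ w≢a | ==-≢ w≢b | ==-≢ u≢w
    = cong (G u w xor_) (toggle-condition (G u a) (G w b) (G u b) (G w a))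

  pivot-row-a : ∀ w → pivot G a b a w ≡ G a w
  pivot-row-a w rewrite ==-refl a = xor-identityʳ (G a w)

  pivot-column-a : ∀ u → pivot G a b u a ≡ G u a
  pivot-column-a u rewrite ==-refl a | ∨-zeroʳ (u == b) | ∨-zeroʳ (u == a) = xor-identityʳ (G u a)

  pivot-diagonal : ∀ u → pivot G a b u u ≡ G u u
  pivot-diagonal u rewrite ==-refl u | ∨-zeroʳ (u == b) | ∨-zeroʳ (u == a) | ∨-zeroʳ (u == b) | ∨-zeroʳ (u == a) = xor-identityʳ (G u u)

zeroAt : ∀ {n} → (Fin n → Bool) → Fin n → (Fin n → Bool)
zeroAt f a k = f k ∧ not (k == a)

zeroAt-here : ∀ {n} (f : Fin n → Bool) a → zeroAt f a a ≡ false
zeroAt-here f a = cong (λ x → f a ∧ not x) (==-refl a) ⟨ trans ⟩ ∧-zeroʳ (f a)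

zeroAt-there : ∀ {n} (f : Fin n → Bool) {a k} → k ≢ a → zeroAt f a k ≡ f k
zeroAt-there f {k = k} k≢a = cong (λ x → f k ∧ not x) (==-≢ k≢a) ⟨ trans ⟩ ∧-identityʳ (f k)

-- Pivoting on a ∈ S, b ∉ S is a congruence transformation of G[S]
module PivotAvoiding {n} (G : Graph n) (symmetric : IsSymmetric G) (a b : Fin n) (Gaa : G a a ≡ false) where

  c : Fin n → Bool
  c = zeroAt (column G b) a

  congruence : Graph n
  congruence = colOp (rowOp G a c) a c

  congruence-entry : ∀ i j → congruence i j ≡ (G i j xor (G a j ∧ c i)) xor (c j ∧ G i a)
  congruence-entry i j rewrite Gaa = cong (λ x → (G i j xor (G a j ∧ c i)) xor (c j ∧ x)) (xor-identityʳ (G i a))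

  congruence≡pivot : ∀ i j → i ≢ b → j ≢ b → congruence i j ≡ pivot G a b i j
  congruence≡pivot i j i≢b j≢b with ≡⊎≢ i a | ≡⊎≢ j a | ≡⊎≢ i j
  ... | inj₁ refl | _ | _ = begin
    congruence a j                                  ≡⟨ congruence-entry a j ⟩
    (G a j xor (G a j ∧ c a)) xor (c j ∧ G a a)     ≡⟨ cong₂ (λ x y → (G a j xor (G a j ∧ x)) xor (c j ∧ y)) (zeroAt-here (column G b) a) Gaa ⟩
    (G a j xor (G a j ∧ false)) xor (c j ∧ false)   ≡⟨ cong₂ (λ x y → (G a j xor x) xor y) (∧-zeroʳ (G a j)) (∧-zeroʳ (c j)) ⟩
    (G a j xor false) xor false                     ≡⟨ xor-identityʳ _ ⟨ trans ⟩ xor-identityʳ (G a j) ⟩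
    G a j                                           ≡⟨ pivot-row-a G a b j ⟨
    pivot G a b a j                                 ∎
    where open ≡-Reasoning
  ... | inj₂ _ | inj₁ refl | _ = begin
    congruence i a                                  ≡⟨ congruence-entry i a ⟩
    (G i a xor (G a a ∧ c i)) xor (c a ∧ G i a)     ≡⟨ cong₂ (λ x y → (G i a xor (x ∧ c i)) xor (y ∧ G i a)) Gaa (zeroAt-here (column G b) a) ⟩
    (G i a xor false) xor false                     ≡⟨ xor-identityʳ _ ⟨ trans ⟩ xor-identityʳ (G i a) ⟩
    G i a                                           ≡⟨ pivot-column-a G a b i ⟨
    pivot G a b i a                                 ∎
    where open ≡-Reasoning
  ... | inj₂ _ | inj₂ _ | inj₁ refl = begin
    congruence i i                                  ≡⟨ congruence-entry i i ⟩
    (G i i xor (G a i ∧ c i)) xor (c i ∧ G i a)     ≡⟨ cong (λ x → (G i i xor (x ∧ c i)) xor (c i ∧ G i a)) (symmetric a i) ⟩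
    (G i i xor (G i a ∧ c i)) xor (c i ∧ G i a)     ≡⟨ cong (λ x → (G i i xor x) xor (c i ∧ G i a)) (∧-comm (G i a) (c i)) ⟩
    (G i i xor (c i ∧ G i a)) xor (c i ∧ G i a)     ≡⟨ xor-cancel (G i i) (c i ∧ G i a) ⟩
    G i i                                           ≡⟨ pivot-diagonal G a b i ⟨
    pivot G a b i i                                 ∎
    where open ≡-Reasoning
  ... | inj₂ i≢a | inj₂ j≢a | inj₂ i≢j = begin
    congruence i j                                  ≡⟨ congruence-entry i j ⟩
    (G i j xor (G a j ∧ c i)) xor (c j ∧ G i a)
      ≡⟨ cong₂ (λ x y → (G i j xor (G a j ∧ x)) xor (y ∧ G i a)) (zeroAt-there (column G b) i≢a) (zeroAt-there (column G b) j≢a) ⟩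
    (G i j xor (G a j ∧ G i b)) xor (G j b ∧ G i a) ≡⟨ cong (λ x → (G i j xor (x ∧ G i b)) xor (G j b ∧ G i a)) (symmetric a j) ⟩
    (G i j xor (G j a ∧ G i b)) xor (G j b ∧ G i a) ≡⟨ xor-regroup (G i j) (G i a) (G j b) (G i b) (G j a) ⟩
    G i j xor ((G i a ∧ G j b) xor (G i b ∧ G j a)) ≡⟨ pivot-inside G a b i≢a i≢b j≢a j≢b i≢j ⟨
    pivot G a b i j                                 ∎
    where open ≡-Reasoning

rankOn-pivot-avoiding : ∀ {n} (G : Graph n) → IsSymmetric G → ∀ a b S → G a a ≡ false →
  lookup S a ≡ true → lookup S b ≡ false → rankOn (pivot G a b) S ≡ rankOn G S
rankOn-pivot-avoiding G symmetric a b S Gaa Sa Sb = begin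
  rankOn (pivot G a b) S                   ≡⟨ rankOn-cong congruence (pivot G a b) S agree ⟨
  rankOn congruence S                      ≡⟨ rankOn-colOp (rowOp G a c) a c S c-a Sa ⟩
  rankOn (rowOp G a c) S                   ≡⟨ rankOn-rowOp G a c S c-a Sa ⟩
  rankOn G S                               ∎
  where
  open PivotAvoiding G symmetric a b Gaa
  open ≡-Reasoning
  c-a = zeroAt-here (column G b) a
  agree : ∀ i j → lookup S i ≡ true → lookup S j ≡ true → congruence i j ≡ pivot G a b i j
  agree i j Si Sj = congruence≡pivot i j (true-false⇒≢ (lookup S) Si Sb) (true-false⇒≢ (lookup S) Sj Sb)

-- Pivoting on a, b ∈ S splits off the nonsingular block of G[S] on {a, b}
module PivotThrough {n} (G : Graph n) (symmetric : IsSymmetric G) {a b : Fin n} (a≢b : a ≢ b)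
  (Gab : G a b ≡ true) (Gaa : G a a ≡ false) (Gbb : G b b ≡ false) where

  c₁ c₂ : Fin n → Bool
  c₁ = zeroAt (zeroAt (column G b) a) b
  c₂ = zeroAt (zeroAt (column G a) a) b

  zeroAt₂-a : ∀ f → zeroAt (zeroAt f a) b a ≡ false
  zeroAt₂-a f = trans (zeroAt-there (zeroAt f a) a≢b) (zeroAt-here f a)

  zeroAt₂-off : ∀ f {k} → k ≢ a → k ≢ b → zeroAt (zeroAt f a) b k ≡ f k
  zeroAt₂-off f k≢a k≢b = trans (zeroAt-there (zeroAt f a) k≢b) (zeroAt-there f k≢a)

  N : Graph n
  N = rowOp (rowOp G a c₁) b c₂

  N-entry : ∀ u w → N u w ≡ (G u w xor (G a w ∧ c₁ u)) xor (G b w ∧ c₂ u)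
  N-entry u w rewrite zeroAt-here (zeroAt (column G b) a) b | ∧-zeroʳ (G a w) =
    cong (λ x → (G u w xor (G a w ∧ c₁ u)) xor (x ∧ c₂ u)) (xor-identityʳ (G b w))

  N-off : ∀ {u} w → u ≢ a → u ≢ b → N u w ≡ (G u w xor (G w a ∧ G u b)) xor (G w b ∧ G u a)
  N-off {u} w u≢a u≢b rewrite N-entry u w | zeroAt₂-off (column G b) u≢a u≢b | zeroAt₂-off (column G a) u≢a u≢b
    = cong₂ (λ x y → (G u w xor (x ∧ G u b)) xor (y ∧ G u a)) (symmetric a w) (symmetric b w)

  N-row-a : ∀ w → N a w ≡ G a w
  N-row-a w rewrite N-entry a w | zeroAt₂-a (column G b) | zeroAt₂-a (column G a) | ∧-zeroʳ (G a w) | ∧-zeroʳ (G b w)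
    = xor-identityʳ _ ⟨ trans ⟩ xor-identityʳ (G a w)

  N-row-b : ∀ w → N b w ≡ G b w
  N-row-b w rewrite N-entry b w | zeroAt-here (zeroAt (column G b) a) b | zeroAt-here (zeroAt (column G a) a) b
                 | ∧-zeroʳ (G a w) | ∧-zeroʳ (G b w)
    = xor-identityʳ _ ⟨ trans ⟩ xor-identityʳ (G b w)

  N-block-null : ∀ {k} → k ≢ a → k ≢ b → N k a ≡ false × N k b ≡ false
  N-block-null {k} k≢a k≢b =
    trans (N-off a k≢a k≢b) (cong₂ (λ x y → (G k a xor (x ∧ G k b)) xor (y ∧ G k a)) Gaa Gab ⟨ trans ⟩
                             cong (_xor G k a) (xor-identityʳ (G k a)) ⟨ trans ⟩ xor-same (G k a)) ,
    trans (N-off b k≢a k≢b) (cong₂ (λ x y → (G k b xor (x ∧ G k b)) xor (y ∧ G k a)) (symmetric b a ⟨ trans ⟩ Gab) Gbb ⟨ trans ⟩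
                             cong (_xor false) (xor-same (G k b)))

  N≡pivot : ∀ {u w} → u ≢ a → u ≢ b → w ≢ a → w ≢ b → N u w ≡ pivot G a b u w
  N≡pivot {u} {w} u≢a u≢b w≢a w≢b with ≡⊎≢ u w
  ... | inj₁ refl = begin
    N u u                                           ≡⟨ N-off u u≢a u≢b ⟩
    (G u u xor (G u a ∧ G u b)) xor (G u b ∧ G u a) ≡⟨ cong (λ x → (G u u xor x) xor (G u b ∧ G u a)) (∧-comm (G u a) (G u b)) ⟩
    (G u u xor (G u b ∧ G u a)) xor (G u b ∧ G u a) ≡⟨ xor-cancel (G u u) (G u b ∧ G u a) ⟩
    G u u                                           ≡⟨ pivot-diagonal G a b u ⟨
    pivot G a b u u                                 ∎
    where open ≡-Reasoning
  ... | inj₂ u≢w = begin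
    N u w                                           ≡⟨ N-off w u≢a u≢b ⟩
    (G u w xor (G w a ∧ G u b)) xor (G w b ∧ G u a) ≡⟨ xor-regroup (G u w) (G u a) (G w b) (G u b) (G w a) ⟩
    G u w xor ((G u a ∧ G w b) xor (G u b ∧ G w a)) ≡⟨ pivot-inside G a b u≢a u≢b w≢a w≢b u≢w ⟨
    pivot G a b u w                                 ∎
    where open ≡-Reasoning

rankOn-pivot-through : ∀ {n} (G : Graph n) → IsSymmetric G → ∀ {a b} S S₀ → a ≢ b →
  G a b ≡ true → G a a ≡ false → G b b ≡ false →
  lookup S a ≡ true → lookup S b ≡ true → lookup S₀ a ≡ false → lookup S₀ b ≡ false →
  (∀ k → k ≢ a → k ≢ b → lookup S₀ k ≡ lookup S k) →
  rankOn G S ≡ 2 + rankOn (pivot G a b) S₀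
rankOn-pivot-through G symmetric {a} {b} S S₀ a≢b Gab Gaa Gbb Sa Sb S₀a S₀b S₀-there = begin
  rankOn G S                      ≡⟨ rankOn-rowOp G a c₁ S (zeroAt₂-a (column G b)) Sa ⟨
  rankOn (rowOp G a c₁) S         ≡⟨ rankOn-rowOp (rowOp G a c₁) b c₂ S (zeroAt-here (zeroAt (column G a) a) b) Sb ⟨
  rankOn N S                      ≡⟨ Block.rankOn-block N S S₀ a≢b Sa Sb S₀a S₀b S₀-there Nab Nba Nbb
                                       (λ k S₀k → N-block-null (off-a S₀k) (off-b S₀k)) ⟩
  2 + rankOn N S₀
    ≡⟨ cong (2 +_) (rankOn-cong N (pivot G a b) S₀ λ u w S₀u S₀w → N≡pivot (off-a S₀u) (off-b S₀u) (off-a S₀w) (off-b S₀w)) ⟩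
  2 + rankOn (pivot G a b) S₀     ∎
  where
  open PivotThrough G symmetric a≢b Gab Gaa Gbb
  open ≡-Reasoning
  off-a : ∀ {k} → lookup S₀ k ≡ true → k ≢ a
  off-a S₀k = true-false⇒≢ (lookup S₀) S₀k S₀a
  off-b : ∀ {k} → lookup S₀ k ≡ true → k ≢ b
  off-b S₀k = true-false⇒≢ (lookup S₀) S₀k S₀b
  Nab = trans (N-row-a b) Gab
  Nba = trans (N-row-b a) (symmetric b a ⟨ trans ⟩ Gab)
  Nbb = trans (N-row-b b) Gbb

-- The interlace polynomial

module Expansion {c ℓ} (R : CommutativeRing c ℓ) (x y : CommutativeRing.Carrier R) where
  open CommutativeRing R hiding (zero; _+_; refl; sym; trans)
  open CommutativeRing R using () renaming (_+_ to _⊞_; refl to ≈-refl; sym to ≈-sym; trans to ≈-trans)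
  open import Relation.Binary.Reasoning.Setoid setoid
  open import Algebra.Properties.CommutativeSemigroup +-commutativeSemigroup using () renaming (interchange to +-interchange)
  module Π = CommutativeMonoidSum *-commutativeMonoid
  open import Algebra.Solver.CommutativeMonoid *-commutativeMonoid using (solve; _⊜_) renaming (_⊕_ to _⊛_; id to I)

  sumSubsets : ∀ n → (Subset n → Carrier) → Carrier
  sumSubsets zero F = F []
  sumSubsets (suc n) F = sumSubsets n (F ∘ (false ∷_)) ⊞ sumSubsets n (F ∘ (true ∷_))

  sumR-++ : ∀ xs ys → sumR R (xs ++ ys) ≈ sumR R xs ⊞ sumR R ys
  sumR-++ [] ys = ≈-sym (+-identityˡ _)
  sumR-++ (z ∷ xs) ys = ≈-trans (+-congˡ (sumR-++ xs ys)) (≈-sym (+-assoc z _ _))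

  sumR≈sumSubsets : ∀ n (F : Subset n → Carrier) → sumR R (map F (subsets n)) ≈ sumSubsets n F
  sumR≈sumSubsets zero F = +-identityʳ (F [])
  sumR≈sumSubsets (suc n) F = begin
    sumR R (map F (map (false ∷_) (subsets n) ++ map (true ∷_) (subsets n)))
      ≡⟨ cong (sumR R) (map-++ F (map (false ∷_) (subsets n)) _) ⟩
    sumR R (map F (map (false ∷_) (subsets n)) ++ map F (map (true ∷_) (subsets n)))
      ≈⟨ sumR-++ (map F (map (false ∷_) (subsets n))) _ ⟩
    sumR R (map F (map (false ∷_) (subsets n))) ⊞ sumR R (map F (map (true ∷_) (subsets n)))
      ≡⟨ cong₂ (λ l l' → sumR R l ⊞ sumR R l') (map-∘ (subsets n)) (map-∘ (subsets n)) ⟨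
    sumR R (map (F ∘ (false ∷_)) (subsets n)) ⊞ sumR R (map (F ∘ (true ∷_)) (subsets n))
      ≈⟨ +-cong (sumR≈sumSubsets n _) (sumR≈sumSubsets n _) ⟩
    sumSubsets (suc n) F ∎

  sumSubsets-cong : ∀ n {F F' : Subset n → Carrier} → (∀ S → F S ≈ F' S) → sumSubsets n F ≈ sumSubsets n F'
  sumSubsets-cong zero h = h []
  sumSubsets-cong (suc n) h = +-cong (sumSubsets-cong n (h ∘ (false ∷_))) (sumSubsets-cong n (h ∘ (true ∷_)))

  sumSubsets-+ : ∀ n (F F' : Subset n → Carrier) → sumSubsets n (λ S → F S ⊞ F' S) ≈ sumSubsets n F ⊞ sumSubsets n F'
  sumSubsets-+ zero F F' = ≈-refl
  sumSubsets-+ (suc n) F F' = ≈-trans (+-cong (sumSubsets-+ n _ _) (sumSubsets-+ n _ _)) (+-interchange _ _ _ _)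

  sumSubsets-* : ∀ n k (F : Subset n → Carrier) → sumSubsets n (λ S → k * F S) ≈ k * sumSubsets n F
  sumSubsets-* zero k F = ≈-refl
  sumSubsets-* (suc n) k F = ≈-trans (+-cong (sumSubsets-* n k _) (sumSubsets-* n k _)) (≈-sym (distribˡ k _ _))

  sumSubsets-insertAt : ∀ m (v : Fin (suc m)) (F : Subset (suc m) → Carrier) →
    sumSubsets (suc m) F ≈ sumSubsets m (λ S → F (insertAt S v false) ⊞ F (insertAt S v true))
  sumSubsets-insertAt m zero F = ≈-sym (sumSubsets-+ m _ _)
  sumSubsets-insertAt (suc m) (suc v) F =
    +-cong (sumSubsets-insertAt m v (F ∘ (false ∷_))) (sumSubsets-insertAt m v (F ∘ (true ∷_)))

  X Y : Carrier
  X = x ⊞ - 1#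
  Y = y ⊞ - 1#

  weight : ∀ {n} → (α β : Fin n → Carrier) → Subset n → Carrier
  weight α β S = Π.sum (λ i → if lookup S i then α i else β i)

  monomial : Carrier → ℕ → ℕ → Carrier
  monomial w r k = (w * pow R X r) * pow R Y (k ∸ r)

  term : ∀ {n} → Graph n → (α β : Fin n → Carrier) → Subset n → Carrier
  term G α β S = monomial (weight α β S) (rankOn G S) (card S)

  q≈sumSubsets : ∀ {n} (G : Graph n) α β → q R x y G α β ≈ sumSubsets n (term G α β)
  q≈sumSubsets {n} G α β = ≈-trans (sumR≈sumSubsets n _) (sumSubsets-cong n λ S → *-congʳ (*-congʳ (split-weight S)))
    where
    split-weight : ∀ S → prodR R (map (λ s → if lookup S s then α s else 1#) (allFin n))
                       * prodR R (map (λ v → if lookup S v then 1# else β v) (allFin n)) ≈ weight α β S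
    split-weight S = begin
      prodR R (map αS (allFin n)) * prodR R (map βS (allFin n))
        ≡⟨ cong₂ _*_ (foldr-map-allFin _*_ 1# αS) (foldr-map-allFin _*_ 1# βS) ⟩
      Π.sum αS * Π.sum βS
        ≈⟨ Π.∑-distrib-+ αS βS ⟨
      Π.sum (λ i → αS i * βS i)
        ≈⟨ Π.sum-cong-≋ pointwise ⟩
      weight α β S ∎
      where
      αS = λ s → if lookup S s then α s else 1#
      βS = λ v → if lookup S v then 1# else β v
      pointwise : ∀ i → αS i * βS i ≈ (if lookup S i then α i else β i)
      pointwise i with lookup S i
      ... | true = *-identityʳ (α i)
      ... | false = *-identityˡ (β i)

  weight-cong : ∀ {n} {α β α' β' : Fin n → Carrier} S → (∀ i → α i ≡ α' i) → (∀ i → β i ≡ β' i) →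
    weight α β S ≈ weight α' β' S
  weight-cong S α≡ β≡ = Π.sum-cong-≋ λ i → reflexive (cong₂ (if lookup S i then_else_) (α≡ i) (β≡ i))

  weight-remove : ∀ {m} (α β : Fin (suc m) → Carrier) v (S : Subset (suc m)) S' →
    (∀ i → lookup S (punchIn v i) ≡ lookup S' i) →
    weight α β S ≈ (if lookup S v then α v else β v) * weight (restrict v α) (restrict v β) S'
  weight-remove α β v S S' S∘punchIn = ≈-trans (Π.sum-remove {i = v} (λ i → if lookup S i then α i else β i))
    (*-congˡ (Π.sum-cong-≋ λ i → reflexive (cong (if_then restrict v α i else restrict v β i) (S∘punchIn i))))

  reassociate : ∀ k w p q → ((k * w) * p) * q ≈ k * ((w * p) * q)
  reassociate = solve 4 (λ k w p q → ((k ⊛ w) ⊛ p) ⊛ q ⊜ k ⊛ ((w ⊛ p) ⊛ q)) ≈-refl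

  term-≈ : ∀ {n n'} (G : Graph n) α β S (G' : Graph n') α' β' S' k →
    rankOn G S ≡ rankOn G' S' → card S ≡ card S' → weight α β S ≈ k * weight α' β' S' →
    term G α β S ≈ k * term G' α' β' S'
  term-≈ G α β S G' α' β' S' k rank≡ card≡ weight≈ = begin
    term G α β S                                              ≡⟨ cong₂ (monomial (weight α β S)) rank≡ card≡ ⟩
    (weight α β S * pow R X r) * pow R Y (size ∸ r)           ≈⟨ *-congʳ (*-congʳ weight≈) ⟩
    ((k * weight α' β' S') * pow R X r) * pow R Y (size ∸ r)  ≈⟨ reassociate k _ _ _ ⟩
    k * term G' α' β' S'                                      ∎
    where
    r = rankOn G' S'
    size = card S'

  -- The nullity (2 + c) ∸ (2 + r) is c ∸ r, so only a factor X² moves into the weight.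
  term-≈₂ : ∀ {n n'} (G : Graph n) α β S (G' : Graph n') α' β' S' k →
    rankOn G S ≡ 2 + rankOn G' S' → card S ≡ 2 + card S' → weight α β S * pow R X 2 ≈ k * weight α' β' S' →
    term G α β S ≈ k * term G' α' β' S'
  term-≈₂ G α β S G' α' β' S' k rank≡ card≡ weight≈ = begin
    term G α β S                                                  ≡⟨ cong₂ (monomial (weight α β S)) rank≡ card≡ ⟩
    (weight α β S * (X * (X * pow R X r))) * pow R Y (size ∸ r)
      ≈⟨ solve 4 (λ w x p q → (w ⊛ (x ⊛ (x ⊛ p))) ⊛ q ⊜ ((w ⊛ (x ⊛ (x ⊛ I))) ⊛ p) ⊛ q) ≈-refl _ X _ _ ⟩
    ((weight α β S * pow R X 2) * pow R X r) * pow R Y (size ∸ r) ≈⟨ *-congʳ (*-congʳ weight≈) ⟩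
    ((k * weight α' β' S') * pow R X r) * pow R Y (size ∸ r)      ≈⟨ reassociate k _ _ _ ⟩
    k * term G' α' β' S'                                          ∎
    where
    r = rankOn G' S'
    size = card S'

  term-insert-false : ∀ {m} (G : Graph (suc m)) α β v S →
    term G α β (insertAt S v false) ≈ β v * term (delete v G) (restrict v α) (restrict v β) S
  term-insert-false G α β v S = term-≈ G α β (insertAt S v false) (delete v G) (restrict v α) (restrict v β) S (β v)
    (rankOn-delete G v (insertAt S v false) S (insertAt-lookup S v false) (insertAt-punchIn S v false))
    (card-delete v (insertAt S v false) S (insertAt-lookup S v false) (insertAt-punchIn S v false))
    (≈-trans (weight-remove α β v (insertAt S v false) S (insertAt-punchIn S v false))
             (reflexive (cong (λ z → (if z then α v else β v) * weight (restrict v α) (restrict v β) S) (insertAt-lookup S v false))))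

  module PivotRecurrence {k} (G : Graph (suc (suc k))) (symmetric : IsSymmetric G) (α β : Fin (suc (suc k)) → Carrier)
    {a b} (a≢b : a ≢ b) (Gab : G a b ≡ true) (Gaa : G a a ≡ false) (Gbb : G b b ≡ false) where

    b' : Fin (suc k)
    b' = punchOut a≢b

    a' : Fin (suc k)
    a' = punchOut (a≢b ∘ sym)

    e : Fin k → Fin (suc (suc k))
    e j = punchIn a (punchIn b' j)

    H : Graph (suc k)
    H = delete b (pivot G a b)

    α′ β′ : Fin (suc k) → Carrier
    α′ = restrict b (alphaPrime R a b α β)
    β′ = restrict b (betaPrime R x a b α β)

    -- S = D u v U has a ∈ S iff u, b ∈ S iff v, and e j ∈ S iff j ∈ U; V u U is its trace on H.
    D : Bool → Bool → Subset k → Subset (suc (suc k))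
    D u v U = insertAt (insertAt U b' v) a u

    V : Bool → Subset k → Subset (suc k)
    V u U = insertAt U a' u

    D-a : ∀ u v U → lookup (D u v U) a ≡ u
    D-a u v U = insertAt-lookup (insertAt U b' v) a u

    D-b : ∀ u v U → lookup (D u v U) b ≡ v
    D-b u v U = trans (cong (lookup (D u v U)) (sym (punchIn-punchOut a≢b)))
                      (trans (insertAt-punchIn (insertAt U b' v) a u b') (insertAt-lookup U b' v))

    D-e : ∀ u v U j → lookup (D u v U) (e j) ≡ lookup U j
    D-e u v U j = trans (insertAt-punchIn (insertAt U b' v) a u _) (insertAt-punchIn U b' v j)

    D-off : ∀ u v u' v' U {i} → i ≢ a → i ≢ b → lookup (D u v U) i ≡ lookup (D u' v' U) i
    D-off u v u' v' U {i} i≢a i≢b with ≡⊎punchIn a i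
    ... | inj₁ i≡a = ⊥-elim (i≢a i≡a)
    ... | inj₂ (i' , refl) with ≡⊎punchIn b' i'
    ...   | inj₁ refl = ⊥-elim (i≢b (punchIn-punchOut a≢b))
    ...   | inj₂ (j , refl) = trans (D-e u v U j) (sym (D-e u' v' U j))

    D-delete-b : ∀ u v U i → lookup (D u v U) (punchIn b i) ≡ lookup (V u U) i
    D-delete-b u v U i with ≡⊎punchIn a' i
    ... | inj₁ refl = trans (cong (lookup (D u v U)) (punchIn-punchOut (a≢b ∘ sym))) (trans (D-a u v U) (sym (insertAt-lookup U a' u)))
    ... | inj₂ (j , refl) = trans (cong (lookup (D u v U)) (sym (punchIn-punchOut-comm a≢b j)))
                                  (trans (D-e u v U j) (sym (insertAt-punchIn U a' u j)))

    rest : Subset k → Carrier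
    rest U = weight (restrict b' (restrict a α)) (restrict b' (restrict a β)) U

    weight-D : ∀ u v U → weight α β (D u v U) ≈ (if u then α a else β a) * ((if v then α b else β b) * rest U)
    weight-D u v U = begin
      weight α β (D u v U)
        ≈⟨ weight-remove α β a (D u v U) (insertAt U b' v) (insertAt-punchIn (insertAt U b' v) a u) ⟩
      (if lookup (D u v U) a then α a else β a) * weight (restrict a α) (restrict a β) (insertAt U b' v)
        ≈⟨ *-congˡ (weight-remove (restrict a α) (restrict a β) b' (insertAt U b' v) U (insertAt-punchIn U b' v)) ⟩
      (if lookup (D u v U) a then α a else β a) * ((if lookup (insertAt U b' v) b' then α (punchIn a b') else β (punchIn a b')) * rest U)
        ≡⟨ cong₂ (λ s t → s * (t * rest U)) (cong (if_then α a else β a) (D-a u v U))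
                 (cong₂ (λ z c → if c then α z else β z) (punchIn-punchOut a≢b) (insertAt-lookup U b' v)) ⟩
      (if u then α a else β a) * ((if v then α b else β b) * rest U) ∎

    weight-V : ∀ u U → weight α′ β′ (V u U) ≈ (if u then β b else α b * pow R X 2) * rest U
    weight-V u U = begin
      weight α′ β′ (V u U)
        ≈⟨ weight-remove α′ β′ a' (V u U) U (insertAt-punchIn U a' u) ⟩
      (if lookup (V u U) a' then α′ a' else β′ a') * weight (restrict a' α′) (restrict a' β′) U
        ≈⟨ *-cong (reflexive (cong₂ (if_then_else (β′ a')) (insertAt-lookup U a' u) α′-a' ⟨ trans ⟩ cong (if u then β b else_) β′-a'))
                  (weight-cong U α′-e β′-e) ⟩
      (if u then β b else α b * pow R X 2) * rest U ∎
      where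
      a-from-b : punchIn b a' ≡ a
      a-from-b = punchIn-punchOut (a≢b ∘ sym)
      α′-a' : α′ a' ≡ β b
      α′-a' = cong (λ z → if z == a then β b else α z) a-from-b ⟨ trans ⟩ cong (if_then β b else α a) (==-refl a)
      β′-a' : β′ a' ≡ α b * pow R X 2
      β′-a' = cong (λ z → if z == a then α b * pow R X 2 else β z) a-from-b ⟨ trans ⟩ cong (if_then α b * pow R X 2 else β a) (==-refl a)
      other : ∀ j → punchIn b (punchIn a' j) ≡ e j
      other j = sym (punchIn-punchOut-comm a≢b j)
      e≢a : ∀ j → e j ≢ a
      e≢a j = punchInᵢ≢i a (punchIn b' j)
      α′-e : ∀ j → α′ (punchIn a' j) ≡ α (e j)
      α′-e j = cong (λ z → if z == a then β b else α z) (other j) ⟨ trans ⟩ cong (if_then β b else α (e j)) (==-≢ (e≢a j))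
      β′-e : ∀ j → β′ (punchIn a' j) ≡ β (e j)
      β′-e j = cong (λ z → if z == a then α b * pow R X 2 else β z) (other j) ⟨ trans ⟩
               cong (if_then α b * pow R X 2 else β (e j)) (==-≢ (e≢a j))

    term-a-without-b : ∀ U → term G α β (D true false U) ≈ α a * term H α′ β′ (V true U)
    term-a-without-b U = term-≈ G α β (D true false U) H α′ β′ (V true U) (α a)
      (trans (sym (rankOn-pivot-avoiding G symmetric a b (D true false U) Gaa (D-a true false U) (D-b true false U)))
             (rankOn-delete (pivot G a b) b (D true false U) (V true U) (D-b true false U) (D-delete-b true false U)))
      (card-delete b (D true false U) (V true U) (D-b true false U) (D-delete-b true false U))
      (≈-trans (weight-D true false U) (*-congˡ (≈-sym (weight-V true U))))

    term-a-with-b : ∀ U → term G α β (D true true U) ≈ α a * term H α′ β′ (V false U)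
    term-a-with-b U = term-≈₂ G α β (D true true U) H α′ β′ (V false U) (α a) rank≡ card≡ weight≈
      where
      D-off-ab : ∀ i → i ≢ a → i ≢ b → lookup (D false false U) i ≡ lookup (D true true U) i
      D-off-ab i = D-off false false true true U
      rank≡ : rankOn G (D true true U) ≡ 2 + rankOn H (V false U)
      rank≡ = trans (rankOn-pivot-through G symmetric (D true true U) (D false false U) a≢b Gab Gaa Gbb
                       (D-a true true U) (D-b true true U) (D-a false false U) (D-b false false U) D-off-ab)
                    (cong (2 +_) (rankOn-delete (pivot G a b) b (D false false U) (V false U)
                                                 (D-b false false U) (D-delete-b false false U)))
      card≡ : card (D true true U) ≡ 2 + card (V false U)
      card≡ = trans (card-two-more (D true true U) (D false false U) a≢b
                       (D-a true true U) (D-b true true U) (D-a false false U) (D-b false false U) D-off-ab)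
                    (cong (2 +_) (card-delete b (D false false U) (V false U) (D-b false false U) (D-delete-b false false U)))
      weight≈ : weight α β (D true true U) * pow R X 2 ≈ α a * weight α′ β′ (V false U)
      weight≈ = begin
        weight α β (D true true U) * pow R X 2       ≈⟨ *-congʳ (weight-D true true U) ⟩
        (α a * (α b * rest U)) * pow R X 2
          ≈⟨ solve 4 (λ p q r s → (p ⊛ (q ⊛ r)) ⊛ s ⊜ p ⊛ ((q ⊛ s) ⊛ r)) ≈-refl (α a) (α b) (rest U) (pow R X 2) ⟩
        α a * ((α b * pow R X 2) * rest U)           ≈⟨ *-congˡ (weight-V false U) ⟨
        α a * weight α′ β′ (V false U)               ∎

    q-recurrence : q R x y G α β ≈ β a * q R x y (delete a G) (restrict a α) (restrict a β) ⊞ α a * q R x y H α′ β′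
    q-recurrence = begin
      q R x y G α β
        ≈⟨ q≈sumSubsets G α β ⟩
      sumSubsets (suc (suc k)) t
        ≈⟨ sumSubsets-insertAt (suc k) a t ⟩
      sumSubsets (suc k) (λ S → t (insertAt S a false) ⊞ t (insertAt S a true))
        ≈⟨ sumSubsets-+ (suc k) (t ∘ λ S → insertAt S a false) (t ∘ λ S → insertAt S a true) ⟩
      sumSubsets (suc k) (t ∘ λ S → insertAt S a false) ⊞ sumSubsets (suc k) (t ∘ λ S → insertAt S a true)
        ≈⟨ +-cong (sumSubsets-cong (suc k) (term-insert-false G α β a)) (sumSubsets-insertAt k b' (t ∘ λ S → insertAt S a true)) ⟩
      sumSubsets (suc k) (λ S → β a * t₁ S) ⊞ sumSubsets k (λ U → t (D true false U) ⊞ t (D true true U))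
        ≈⟨ +-cong (sumSubsets-* (suc k) (β a) t₁) (sumSubsets-cong k λ U →
             ≈-trans (+-cong (term-a-without-b U) (term-a-with-b U)) (≈-trans (+-comm _ _) (≈-sym (distribˡ (α a) _ _)))) ⟩
      β a * sumSubsets (suc k) t₁ ⊞ sumSubsets k (λ U → α a * (t₂ (V false U) ⊞ t₂ (V true U)))
        ≈⟨ +-cong (*-congˡ (≈-sym (q≈sumSubsets (delete a G) (restrict a α) (restrict a β))))
                  (sumSubsets-* k (α a) (λ U → t₂ (V false U) ⊞ t₂ (V true U))) ⟩
      β a * q R x y (delete a G) (restrict a α) (restrict a β) ⊞ α a * sumSubsets k (λ U → t₂ (V false U) ⊞ t₂ (V true U))
        ≈⟨ +-congˡ (*-congˡ (≈-trans (≈-sym (sumSubsets-insertAt k a' t₂)) (≈-sym (q≈sumSubsets H α′ β′)))) ⟩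
      β a * q R x y (delete a G) (restrict a α) (restrict a β) ⊞ α a * q R x y H α′ β′ ∎
      where
      t = term G α β
      t₁ = term (delete a G) (restrict a α) (restrict a β)
      t₂ = term H α′ β′

corollary1 : ∀ {c ℓ} (R : CommutativeRing c ℓ)
    (x y : CommutativeRing.Carrier R) (m : ℕ) (G : Graph (suc m)) → IsSymmetric G →
    (α β : Fin (suc m) → CommutativeRing.Carrier R) (a b : Fin (suc m)) →
    a ≢ b → G a b ≡ true → G a a ≡ false → G b b ≡ false →
    CommutativeRing._≈_ R (q R x y G α β)
      (CommutativeRing._+_ R
        (CommutativeRing._*_ R (β a) (q R x y (delete a G) (restrict a α) (restrict a β)))
        (CommutativeRing._*_ R (α a)
          (q R x y (delete b (pivot G a b))
            (restrict b (alphaPrime R a b α β))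
            (restrict b (betaPrime R x a b α β)))))
corollary1 R x y zero G symmetric α β zero zero a≢b Gab Gaa Gbb = ⊥-elim (a≢b refl)
corollary1 R x y (suc k) G symmetric α β a b a≢b Gab Gaa Gbb =
  Expansion.PivotRecurrence.q-recurrence R x y G symmetric α β a≢b Gab Gaa Gbb
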